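{- Let $\mathbf m=(m_1,\dots,m_n)$ be positive integers, $M=\sum_i m_i$, $M_i=\sum_{k=1}^i m_k$ ($M_0=0$). Identify each barcode $s\in\mathbf{BL}(\mathbf m)$ with the permutation of $[M]$ (in one-line notation) obtained by replacing the $j$-th occurrence of label $i$ in $s$ by $M_{i-1}+j$. Then the Möbius function of $\mathbf{BL}(\mathbf m)$ is the restriction of the Möbius function of $S_M$ under the weak Bruhat order; that is, for $s\le t$ in $\mathbf{BL}(\mathbf m)$, \[\mu(s,t)=\begin{cases}(-1)^{|J|}&\text{if } t=s\,w_0(J)\text{ for some subset } J\text{ of the simple transpositions of } S_M,\\ 0&\text{otherwise,}\end{cases}\] where $w_0(J)$ is the top (longest) element of the subgroup of $S_M$ generated by $J$.
   Context: $\mathbf{BL}(\mathbf m)$ is the set of words of the multiset with $m_i$ copies of $i$ ($i\in[n]$) in which, for each $i\in[n-1]$, the first occurrence of $i$ precedes the first occurrence of $i+1$; it is ordered by the reflexive-transitive closure of: $s\lessdot t$ iff $t$ arises from $s$ by swapping two adjacent entries $a<b$ appearing as $ab$ in $s$. The weak Bruhat order on $S_M$ is the reflexive-transitive closure of: $\sigma\lessdot\tau$ iff $\tau$ arises from $\sigma$ (one-line notation) by swapping two adjacent increasing entries. The simple transpositions are $s_k=(k,k+1)$, $k\in[M-1]$; the product $s\,w_0(J)$ is composition of permutations, where right multiplication by $s_k$ swaps the entries in positions $k,k+1$. -}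

module Defs where

open import Data.Nat as ℕ using (ℕ; zero; suc; _+_; _∸_; _<_; _≤_; _<ᵇ_)
open import Data.Integer as ℤ using (ℤ; 0ℤ; 1ℤ; -1ℤ)
open import Data.Bool using (Bool; true; false; if_then_else_)
open import Data.List using (List; []; _∷_; _++_; replicate; length; take; foldr; map; upTo)
open import Data.List.Properties using (≡-dec)
open import Data.List.Membership.Propositional using (_∈_)
open import Data.List.Relation.Unary.Unique.Propositional using (Unique)
open import Data.List.Relation.Binary.Permutation.Propositional using (_↭_)
open import Data.Fin using (Fin; toℕ)
open import Data.Fin.Subset using (Subset; _∈_)
open import Data.Product using (Σ; _×_; ∃)
open import Function.Bundles using (_⇔_)
open import Relation.Binary.PropositionalEquality using (_≡_)
open import Relation.Binary.Construct.Closure.ReflexiveTransitive using (Star)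
open import Relation.Nullary.Decidable using (⌊_⌋)

-- Words and the barcode poset BL(m)
-- m = (m₁,…,mₙ) is a list of naturals, n = length m; labels are 1,…,n.

msetFrom : ℕ → List ℕ → List ℕ
msetFrom k []       = []
msetFrom k (x ∷ xs) = replicate x k ++ msetFrom (suc k) xs

mset : List ℕ → List ℕ
mset = msetFrom 1

-- 0-based position of the first occurrence of i in w (length w if absent)
firstOcc : ℕ → List ℕ → ℕ
firstOcc i []       = 0
firstOcc i (x ∷ w)  = if ⌊ x ℕ.≟ i ⌋ then 0 else suc (firstOcc i w)

BL : List ℕ → List ℕ → Set
BL m s = (s ↭ mset m)
       × (∀ i → 1 ≤ i → i < length m → firstOcc i s < firstOcc (suc i) s)

data AdjSwap : List ℕ → List ℕ → Set where
  adjSwap : ∀ xs ys a b → a < b → AdjSwap (xs ++ a ∷ b ∷ ys) (xs ++ b ∷ a ∷ ys)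

BLStep : List ℕ → List ℕ → List ℕ → Set
BLStep m s t = BL m s × BL m t × AdjSwap s t

_≤BL[_]_ : List ℕ → List ℕ → List ℕ → Set
s ≤BL[ m ] t = Star (BLStep m) s t

-- The interval [s,t] is given by any duplicate-free list enumerating it.

sumℤ : List ℤ → ℤ
sumℤ = foldr ℤ._+_ 0ℤ

δ : List ℕ → List ℕ → ℤ
δ s t = if ⌊ ≡-dec ℕ._≟_ s t ⌋ then 1ℤ else 0ℤ

IsMobius : (List ℕ → Set) → (List ℕ → List ℕ → Set) → (List ℕ → List ℕ → ℤ) → Set
IsMobius P _≼_ μ =
  ∀ s t → P s → P t → s ≼ t →
  (L : List (List ℕ)) → Unique L →
  (∀ u → (u Data.List.Membership.Propositional.∈ L) ⇔ (P u × s ≼ u × u ≼ t)) →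
  sumℤ (map (μ s) L) ≡ δ s t

partialSum : List ℕ → ℕ → ℕ
partialSum m i = foldr _+_ 0 (take i m)

totalM : List ℕ → ℕ
totalM m = foldr _+_ 0 m

update : (ℕ → ℕ) → ℕ → ℕ → ℕ
update c i j = if ⌊ j ℕ.≟ i ⌋ then suc (c j) else c j

-- c i = number of occurrences of i seen so far
stdz : List ℕ → (ℕ → ℕ) → List ℕ → List ℕ
stdz m c []      = []
stdz m c (i ∷ w) = (partialSum m (i ∸ 1) + suc (c i)) ∷ stdz m (update c i) w

toPerm : List ℕ → List ℕ → List ℕ
toPerm m s = stdz m (λ _ → 0) s

-- entry at 0-based position k (0 if out of range)
nth : List ℕ → ℕ → ℕ
nth []      k       = 0
nth (x ∷ _) zero    = x
nth (_ ∷ w) (suc k) = nth w k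

-- composition σ·w : i ↦ σ(w(i)), in one-line notation
compose : List ℕ → List ℕ → List ℕ
compose σ w = map (λ j → nth σ (j ∸ 1)) w

-- right multiplication by s_{k+1}: swap entries at 0-based positions k, k+1
swapAt : ℕ → List ℕ → List ℕ
swapAt k       []            = []
swapAt k       (x ∷ [])      = x ∷ []
swapAt zero    (x ∷ y ∷ w)   = y ∷ x ∷ w
swapAt (suc k) (x ∷ w)       = x ∷ swapAt k w

idPerm : ℕ → List ℕ
idPerm M = map suc (upTo M)

-- number of inversions = Coxeter length in S_M
countLess : ℕ → List ℕ → ℕ
countLess x []      = 0
countLess x (y ∷ w) = if y <ᵇ x then suc (countLess x w) else countLess x w

inv : List ℕ → ℕ
inv []      = 0
inv (x ∷ w) = countLess x w + inv w

-- J ⊆ {s₁,…,s_{M-1}}, encoded as a subset of Fin (M ∸ 1); index k stands for s_{k+1}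
-- one generator step: w ↦ w·s_k with s_k ∈ J
GenStep : (M : ℕ) → Subset (M ∸ 1) → List ℕ → List ℕ → Set
GenStep M J u v = Σ (Fin (M ∸ 1)) λ k → (k Data.Fin.Subset.∈ J) × (v ≡ swapAt (toℕ k) u)

InParabolic : (M : ℕ) → Subset (M ∸ 1) → List ℕ → Set
InParabolic M J w = Star (GenStep M J) (idPerm M) w

IsW0 : (M : ℕ) → Subset (M ∸ 1) → List ℕ → Set
IsW0 M J w = InParabolic M J w × (∀ w' → InParabolic M J w' → inv w' ≤ inv w)

sign : ℕ → ℤ
sign k = -1ℤ ℤ.^ k

{-# OPTIONS --safe #-}
module Submission where

-- Under standardization σ the order of BL(m) is the weak order of S_M: u ≤ v iff every
-- inversion of σ u is an inversion of σ v, and a word of the multiset lying below a barcode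
-- in this sense is again a barcode.  Fix s ≤ t.  If s ascends at every position of J then
-- σ (s·w₀(J)) = σ s · w₀(J), and s·w₀(J) lies in [s, t] iff every s·s_k with s_k ∈ J is an
-- atom of [s, t].  Hence  f u = Σ_J [s ascends on J] [u = s·w₀(J)] (-1)^|J|  sums over [s, t]
-- to Σ_{J ⊆ atoms} (-1)^|J| = δ(s, t), so μ(s, t) = f t by induction on inv t.
-- Finally J is recovered from s·w₀(J), so f t = (-1)^|J| if σ t = σ s · w₀(J) and 0 otherwise.

open import Defs
open import Algebra.Bundles using (AbelianGroup)
open import Data.Bool as Bool using (Bool; true; false; if_then_else_; _∧_; T)
open import Data.Bool.Properties using (T-≡)
open import Data.Empty using (⊥; ⊥-elim)
open import Data.Fin using (Fin; toℕ)
import Data.Fin as Fin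
open import Data.Fin.Properties using (toℕ<n)
open import Data.Fin.Subset using (Subset; ∣_∣)
import Data.Fin.Subset as Sub
open import Data.Integer as ℤ using (ℤ; 0ℤ; 1ℤ; -1ℤ) renaming (_+_ to _+ℤ_; -_ to -ℤ_; _*_ to _*ℤ_)
import Data.Integer.Properties as ℤ
open import Algebra.Properties.CommutativeSemigroup ℤ.+-commutativeSemigroup using (interchange)
open import Algebra.Properties.Group (AbelianGroup.group ℤ.+-0-abelianGroup) using (∙-cancelˡ; ∙-cancelʳ)
open import Data.List
  using (List; []; _∷_; _++_; length; map; take; replicate; applyUpTo; upTo; filter; deduplicate; cartesianProductWith)
open import Data.List.Properties
  using ( length-map; length-applyUpTo; length-++; length-replicate; take-all; take-[]; ≡-dec
        ; filter-accept; filter-reject; filter-++)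
open import Data.List.Membership.Propositional using (_∈_)
open import Data.List.Membership.Propositional.Properties
  using (∈-++⁻; ∈-cartesianProductWith⁺; ∈-upTo⁺; ∈-filter⁺; ∈-filter⁻; ∈-deduplicate⁺; ∈-deduplicate⁻)
open import Data.List.Relation.Binary.Permutation.Propositional using (_↭_; ↭-trans; prep; swap)
open import Data.List.Relation.Binary.Permutation.Propositional.Properties using (↭-length; ∈-resp-↭; filter-↭)
open import Data.List.Relation.Unary.All using (All; []; _∷_)
import Data.List.Relation.Unary.All as All
open import Data.List.Relation.Unary.AllPairs using ([]; _∷_)
open import Data.List.Relation.Unary.Any using (here; there)
open import Data.List.Relation.Unary.Unique.Propositional using (Unique)
open import Data.List.Relation.Unary.Unique.DecPropositional.Properties using (deduplicate-!)
open import Data.Nat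
open import Data.Nat.Properties
open import Algebra.Properties.CommutativeSemigroup +-commutativeSemigroup using (x∙yz≈y∙xz)
open import Data.Product using (∃; _×_; _,_; proj₁; proj₂)
open import Data.Sum using (_⊎_; inj₁; inj₂; [_,_])
open import Data.Vec using ([]; _∷_; here; there)
open import Data.Vec.Properties using (∷-injectiveʳ)
open import Function using (_∘_; Equivalence; mk⇔)
open import Relation.Binary.Construct.Closure.ReflexiveTransitive as Star using (Star; ε; _◅_; _◅◅_)
open import Relation.Binary.Definitions using (tri<; tri≈; tri>)
open import Relation.Binary.PropositionalEquality hiding ([_])
open import Relation.Nullary using (¬_; Dec; yes; no; does; _×-dec_; _→-dec_)
open import Relation.Nullary.Decidable using (map′; dec-true; dec-false)

-- Entries of lists and adjacent transpositions

nth-map : ∀ (f : ℕ → ℕ) xs {i} → i < length xs → nth (map f xs) i ≡ f (nth xs i)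
nth-map f (x ∷ xs) {zero}  _         = refl
nth-map f (x ∷ xs) {suc i} (s≤s i<n) = nth-map f xs i<n

nth-applyUpTo : ∀ (f : ℕ → ℕ) {n i} → i < n → nth (applyUpTo f n) i ≡ f i
nth-applyUpTo f {suc n} {zero}  _         = refl
nth-applyUpTo f {suc n} {suc i} (s≤s i<n) = nth-applyUpTo (λ j → f (suc j)) i<n

nth-ext : ∀ {xs ys} → length xs ≡ length ys → (∀ i → i < length xs → nth xs i ≡ nth ys i) → xs ≡ ys
nth-ext {[]}     {[]}     _  _ = refl
nth-ext {x ∷ xs} {y ∷ ys} eq f =
  cong₂ _∷_ (f zero z<s) (nth-ext (suc-injective eq) (λ i i<n → f (suc i) (s≤s i<n)))

length-idPerm : ∀ M → length (idPerm M) ≡ M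
length-idPerm M = trans (length-map suc (upTo M)) (length-applyUpTo (λ i → i) M)

nth-idPerm : ∀ {M i} → i < M → nth (idPerm M) i ≡ suc i
nth-idPerm {M} i<M =
  trans (nth-map suc (upTo M) (subst (_ <_) (sym (length-applyUpTo (λ i → i) M)) i<M))
        (cong suc (nth-applyUpTo (λ i → i) i<M))

length-swapAt : ∀ k w → length (swapAt k w) ≡ length w
length-swapAt k       []          = refl
length-swapAt k       (x ∷ [])    = refl
length-swapAt zero    (x ∷ y ∷ w) = refl
length-swapAt (suc k) (x ∷ y ∷ w) = cong suc (length-swapAt k (y ∷ w))

swapAt-suc : ∀ x k w → swapAt (suc k) (x ∷ w) ≡ x ∷ swapAt k w
swapAt-suc x k []      = refl
swapAt-suc x k (y ∷ w) = refl

swapAt-involutive : ∀ k w → swapAt k (swapAt k w) ≡ w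
swapAt-involutive k       []          = refl
swapAt-involutive k       (x ∷ [])    = refl
swapAt-involutive zero    (x ∷ y ∷ w) = refl
swapAt-involutive (suc k) (x ∷ y ∷ w) =
  trans (swapAt-suc x k _) (cong (x ∷_) (swapAt-involutive k (y ∷ w)))

map-swapAt : ∀ (f : ℕ → ℕ) k w → map f (swapAt k w) ≡ swapAt k (map f w)
map-swapAt f k       []          = refl
map-swapAt f k       (x ∷ [])    = refl
map-swapAt f zero    (x ∷ y ∷ w) = refl
map-swapAt f (suc k) (x ∷ y ∷ w) = cong (f x ∷_) (map-swapAt f k (y ∷ w))

swapAt-↭ : ∀ k w → swapAt k w ↭ w
swapAt-↭ k       []          = _↭_.refl
swapAt-↭ k       (x ∷ [])    = _↭_.refl
swapAt-↭ zero    (x ∷ y ∷ w) = swap y x _↭_.refl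
swapAt-↭ (suc k) (x ∷ y ∷ w) = prep x (swapAt-↭ k (y ∷ w))

swapIndex : ℕ → ℕ → ℕ
swapIndex k i with i ≟ k
... | yes _ = suc k
... | no _ with i ≟ suc k
...   | yes _ = k
...   | no _  = i

swapIndex-involutive : ∀ k i → swapIndex k (swapIndex k i) ≡ i
swapIndex-involutive k i with i ≟ k
... | yes refl with suc i ≟ i
...   | yes e = ⊥-elim (1+n≢n e)
...   | no _ with suc i ≟ suc i
...     | yes _ = refl
...     | no ne = ⊥-elim (ne refl)
swapIndex-involutive k i | no i≢k with i ≟ suc k
... | yes refl with k ≟ k
...   | yes _ = refl
...   | no ne = ⊥-elim (ne refl)
swapIndex-involutive k i | no i≢k | no i≢1+k with i ≟ k
... | yes e = ⊥-elim (i≢k e)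
... | no _ with i ≟ suc k
...   | yes e = ⊥-elim (i≢1+k e)
...   | no _  = refl

swapIndex-< : ∀ {k n} i → suc k < n → i < n → swapIndex k i < n
swapIndex-< {k} i k+1<n i<n with i ≟ k
... | yes refl = k+1<n
... | no _ with i ≟ suc k
...   | yes refl = <-trans (n<1+n k) k+1<n
...   | no _     = i<n

swapIndex-mono : ∀ k {i j} → i < j → ¬ (i ≡ k × j ≡ suc k) → swapIndex k i < swapIndex k j
swapIndex-mono k {i} {j} i<j not-kk+1 with i ≟ k | j ≟ k
... | yes refl | yes refl = ⊥-elim (<-irrefl refl i<j)
... | no i≢k   | yes refl with i ≟ suc k
...   | yes refl = ⊥-elim (<-asym i<j (n<1+n k))
...   | no _     = <-trans i<j (n<1+n k)
swapIndex-mono k {i} {j} i<j not-kk+1 | yes refl | no j≢k with j ≟ suc k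
... | yes refl   = ⊥-elim (not-kk+1 (refl , refl))
... | no j≢1+k   = ≤∧≢⇒< i<j (λ e → j≢1+k (sym e))
swapIndex-mono k {i} {j} i<j not-kk+1 | no i≢k | no j≢k with i ≟ suc k | j ≟ suc k
... | yes refl | yes refl = ⊥-elim (<-irrefl refl i<j)
... | yes refl | no _     = <-trans (n<1+n k) i<j
... | no _     | yes refl = ≤∧≢⇒< (m<1+n⇒m≤n i<j) i≢k
... | no _     | no _     = i<j

nth-swapAt-at : ∀ k w → suc k < length w → nth (swapAt k w) k ≡ nth w (suc k)
nth-swapAt-at zero    (x ∷ y ∷ w) _           = refl
nth-swapAt-at (suc k) (x ∷ y ∷ w) (s≤s k+1<n) = nth-swapAt-at k (y ∷ w) k+1<n
nth-swapAt-at zero    (x ∷ [])    (s≤s ())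
nth-swapAt-at (suc k) (x ∷ [])    (s≤s ())

nth-swapAt-at-suc : ∀ k w → suc k < length w → nth (swapAt k w) (suc k) ≡ nth w k
nth-swapAt-at-suc zero    (x ∷ y ∷ w) _           = refl
nth-swapAt-at-suc (suc k) (x ∷ y ∷ w) (s≤s k+1<n) = nth-swapAt-at-suc k (y ∷ w) k+1<n
nth-swapAt-at-suc zero    (x ∷ [])    (s≤s ())
nth-swapAt-at-suc (suc k) (x ∷ [])    (s≤s ())

nth-swapAt-other : ∀ k w i → i ≢ k → i ≢ suc k → nth (swapAt k w) i ≡ nth w i
nth-swapAt-other k       []          i             _ _ = refl
nth-swapAt-other k       (x ∷ [])    i             _ _ = refl
nth-swapAt-other zero    (x ∷ y ∷ w) zero          i≢k _     = ⊥-elim (i≢k refl)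
nth-swapAt-other zero    (x ∷ y ∷ w) (suc zero)    _   i≢1+k = ⊥-elim (i≢1+k refl)
nth-swapAt-other zero    (x ∷ y ∷ w) (suc (suc i)) _   _     = refl
nth-swapAt-other (suc k) (x ∷ y ∷ w) zero          _   _     = refl
nth-swapAt-other (suc k) (x ∷ y ∷ w) (suc i)       i≢k i≢1+k =
  nth-swapAt-other k (y ∷ w) i (i≢k ∘ cong suc) (i≢1+k ∘ cong suc)

nth-swapAt-swapIndex : ∀ k w i → suc k < length w → nth (swapAt k w) (swapIndex k i) ≡ nth w i
nth-swapAt-swapIndex k w i k+1<n with i ≟ k
... | yes refl = nth-swapAt-at-suc k w k+1<n
... | no i≢k with i ≟ suc k
...   | yes refl  = nth-swapAt-at k w k+1<n
...   | no i≢1+k = nth-swapAt-other k w i i≢k i≢1+k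

nth-swapAt : ∀ k w i → suc k < length w → nth (swapAt k w) i ≡ nth w (swapIndex k i)
nth-swapAt k w i k+1<n =
  trans (cong (nth (swapAt k w)) (sym (swapIndex-involutive k i)))
        (nth-swapAt-swapIndex k w (swapIndex k i) k+1<n)

-- Relative order of values and inversion sets

Distinct : List ℕ → Set
Distinct π = ∀ i j → i < length π → j < length π → nth π i ≡ nth π j → i ≡ j

Occurs : ℕ → List ℕ → Set
Occurs x π = ∃ λ i → i < length π × nth π i ≡ x

Precedes : List ℕ → ℕ → ℕ → Set
Precedes π x y = ∃ λ i → ∃ λ j → i < j × j < length π × nth π i ≡ x × nth π j ≡ y

-- Containment of inversion sets (pairs of values out of order): the weak order on S_M.
_⊆Inv_ : List ℕ → List ℕ → Set
π ⊆Inv ρ = ∀ x y → x < y → Precedes π y x → Precedes ρ y x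

⊆Inv-trans : ∀ {π ρ κ} → π ⊆Inv ρ → ρ ⊆Inv κ → π ⊆Inv κ
⊆Inv-trans π⊆ρ ρ⊆κ x y x<y = ρ⊆κ x y x<y ∘ π⊆ρ x y x<y

precedes-trans : ∀ {π x y z} → Distinct π → Precedes π x y → Precedes π y z → Precedes π x z
precedes-trans dist (i , j , i<j , j<n , πi , πj) (j′ , k , j′<k , k<n , πj′ , πk)
  with dist j j′ j<n (<-trans j′<k k<n) (trans πj (sym πj′))
... | refl = i , k , <-trans i<j j′<k , k<n , πi , πk

precedes-asym : ∀ {π x y} → Distinct π → Precedes π x y → ¬ Precedes π y x
precedes-asym dist (i , j , i<j , j<n , πi , πj) (j′ , i′ , j′<i′ , i′<n , πj′ , πi′)
  with dist j j′ j<n (<-trans j′<i′ i′<n) (trans πj (sym πj′))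
     | dist i i′ (<-trans i<j j<n) i′<n (trans πi (sym πi′))
... | refl | refl = <-asym i<j j′<i′

precedes-total : ∀ {π x y} → Occurs x π → Occurs y π → x ≢ y → Precedes π x y ⊎ Precedes π y x
precedes-total (i , i<n , πi) (j , j<n , πj) x≢y with <-cmp i j
... | tri< i<j _ _ = inj₁ (i , j , i<j , j<n , πi , πj)
... | tri≈ _ refl _ = ⊥-elim (x≢y (trans (sym πi) πj))
... | tri> _ _ j<i = inj₂ (j , i , j<i , i<n , πj , πi)

precedes? : ∀ π x y → Dec (Precedes π x y)
precedes? π x y with anyUpTo? (λ j → anyUpTo? (λ i → nth π i ≟ x) j ×-dec (nth π j ≟ y)) (length π)
... | yes (j , j<n , (i , i<j , πi) , πj) = yes (i , j , i<j , j<n , πi , πj)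
... | no none = no λ (i , j , i<j , j<n , πi , πj) → none (j , j<n , (i , i<j , πi) , πj)

-- The ρ-position of π_i is at least i (induction from the left end) and at most i
-- (induction from the right end).
module _ {π ρ : List ℕ} (dist : Distinct ρ) (same-length : length π ≡ length ρ)
         (consecutive : ∀ k → suc k < length π → Precedes ρ (nth π k) (nth π (suc k))) where

  private
    position-≥ : ∀ i a → i < length π → a < length ρ → nth ρ a ≡ nth π i → i ≤ a
    position-≥ zero    a _ _ _ = z≤n
    position-≥ (suc i) a i<n a<n ρa with consecutive i i<n
    ... | a′ , b′ , a′<b′ , b′<n , ρa′ , ρb′ with dist a b′ a<n b′<n (trans ρa (sym ρb′))
    ...   | refl =
      <-≤-trans (s≤s (position-≥ i a′ (<-trans (n<1+n i) i<n) (<-trans a′<b′ b′<n) ρa′)) a′<b′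

    position-≤ : ∀ d i a → suc (i + d) ≡ length π → a < length ρ → nth ρ a ≡ nth π i → a ≤ i
    position-≤ zero i a i+1≡n a<n _ =
      m<1+n⇒m≤n (subst (a <_) (trans (sym same-length) (trans (sym i+1≡n) (cong suc (+-identityʳ i)))) a<n)
    position-≤ (suc d) i a i+d+2≡n a<n ρa
      with consecutive i (subst (suc i <_) i+d+2≡n (s≤s (subst (suc i ≤_) (sym (+-suc i d)) (s≤s (m≤m+n i d)))))
    ... | a′ , b′ , a′<b′ , b′<n , ρa′ , ρb′ with dist a a′ a<n (<-trans a′<b′ b′<n) (trans ρa (sym ρa′))
    ...   | refl = m<1+n⇒m≤n (<-≤-trans a′<b′
                     (position-≤ d (suc i) b′ (trans (cong suc (sym (+-suc i d))) i+d+2≡n) b′<n ρb′))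

  consecutive-precedes⇒≡ : (∀ i → i < length π → Occurs (nth π i) ρ) → π ≡ ρ
  consecutive-precedes⇒≡ occurs = nth-ext same-length λ i i<n → at i i<n (occurs i i<n)
    where
    at : ∀ i → i < length π → Occurs (nth π i) ρ → nth π i ≡ nth ρ i
    at i i<n (a , a<n , ρa) with m≤n⇒∃[o]m+o≡n i<n
    ... | d , i+d+1≡n with ≤-antisym (position-≤ d i a i+d+1≡n a<n ρa) (position-≥ i a i<n a<n ρa)
    ...   | refl = sym ρa

⊆Inv-swapAt-ascent : ∀ k π → suc k < length π → nth π k < nth π (suc k) → π ⊆Inv swapAt k π
⊆Inv-swapAt-ascent k π k+1<n ascent x y x<y (i , j , i<j , j<n , πi , πj) =
  swapIndex k i , swapIndex k j , swapIndex-mono k i<j not-kk+1 ,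
  subst (swapIndex k j <_) (sym (length-swapAt k π)) (swapIndex-< j k+1<n j<n) ,
  trans (nth-swapAt-swapIndex k π i k+1<n) πi , trans (nth-swapAt-swapIndex k π j k+1<n) πj
  where
  not-kk+1 : ¬ (i ≡ k × j ≡ suc k)
  not-kk+1 (refl , refl) = <-asym x<y (subst₂ _<_ πi πj ascent)

precedes-swapAt : ∀ k π {x y} → suc k < length π → Precedes (swapAt k π) x y →
                  Precedes π x y ⊎ (x ≡ nth π (suc k) × y ≡ nth π k)
precedes-swapAt k π k+1<n (i , j , i<j , j<n , πi , πj) with (i ≟ k) ×-dec (j ≟ suc k)
... | yes (refl , refl) =
  inj₂ (trans (sym πi) (nth-swapAt-at k π k+1<n) , trans (sym πj) (nth-swapAt-at-suc k π k+1<n))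
... | no not-kk+1 =
  inj₁ (swapIndex k i , swapIndex k j , swapIndex-mono k i<j not-kk+1 ,
        swapIndex-< j k+1<n (subst (j <_) (length-swapAt k π) j<n) ,
        trans (sym (nth-swapAt k π i k+1<n)) πi , trans (sym (nth-swapAt k π j k+1<n)) πj)

precedes-swapAt-at : ∀ k π → suc k < length π → Precedes (swapAt k π) (nth π (suc k)) (nth π k)
precedes-swapAt-at k π k+1<n =
  k , suc k , n<1+n k , subst (suc k <_) (sym (length-swapAt k π)) k+1<n ,
  nth-swapAt-at k π k+1<n , nth-swapAt-at-suc k π k+1<n

swapAt-⊆Inv : ∀ k π ρ → suc k < length π → π ⊆Inv ρ →
              Precedes ρ (nth π (suc k)) (nth π k) → swapAt k π ⊆Inv ρ
swapAt-⊆Inv k π ρ k+1<n π⊆ρ ρ-reversed x y x<y swapped with precedes-swapAt k π k+1<n swapped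
... | inj₁ π-inversion = π⊆ρ x y x<y π-inversion
... | inj₂ (refl , refl) = ρ-reversed

distinct-swapAt : ∀ k π → suc k < length π → Distinct π → Distinct (swapAt k π)
distinct-swapAt k π k+1<n dist i j i<n j<n same =
  trans (sym (swapIndex-involutive k i))
    (trans (cong (swapIndex k)
             (dist (swapIndex k i) (swapIndex k j) (bounded i i<n) (bounded j j<n)
               (trans (sym (nth-swapAt k π i k+1<n)) (trans same (nth-swapAt k π j k+1<n)))))
           (swapIndex-involutive k j))
  where
  bounded : ∀ i → i < length (swapAt k π) → swapIndex k i < length π
  bounded i i<n = swapIndex-< i k+1<n (subst (i <_) (length-swapAt k π) i<n)

occurs-swapAt : ∀ k π {x} → suc k < length π → Occurs x π → Occurs x (swapAt k π)
occurs-swapAt k π k+1<n (i , i<n , πi) =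
  swapIndex k i , subst (swapIndex k i <_) (sym (length-swapAt k π)) (swapIndex-< i k+1<n i<n) ,
  trans (nth-swapAt-swapIndex k π i k+1<n) πi

-- The inversion number

<ᵇ-true : ∀ {a b} → a < b → (a <ᵇ b) ≡ true
<ᵇ-true a<b = Equivalence.to T-≡ (<⇒<ᵇ a<b)

<ᵇ-false : ∀ {a b} → ¬ (a < b) → (a <ᵇ b) ≡ false
<ᵇ-false {a} {b} a≮b with a <ᵇ b in eq
... | true  = ⊥-elim (a≮b (<ᵇ⇒< a b (subst T (sym eq) _)))
... | false = refl

countLess-swapAt : ∀ x k w → countLess x (swapAt k w) ≡ countLess x w
countLess-swapAt x k       []          = refl
countLess-swapAt x k       (y ∷ [])    = refl
countLess-swapAt x zero    (a ∷ b ∷ w) with b <ᵇ x | a <ᵇ x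
... | true  | true  = refl
... | true  | false = refl
... | false | true  = refl
... | false | false = refl
countLess-swapAt x (suc k) (a ∷ b ∷ w) with a <ᵇ x
... | true  = cong suc (countLess-swapAt x k (b ∷ w))
... | false = countLess-swapAt x k (b ∷ w)

inv-swapAt-ascent : ∀ k w → suc k < length w → nth w k < nth w (suc k) → inv (swapAt k w) ≡ suc (inv w)
inv-swapAt-ascent zero (a ∷ b ∷ w) _ a<b rewrite <ᵇ-true a<b | <ᵇ-false (<-asym a<b) =
  cong suc (x∙yz≈y∙xz (countLess b w) (countLess a w) (inv w))
inv-swapAt-ascent (suc k) (x ∷ y ∷ w) (s≤s k+1<n) ascent =
  trans (cong₂ _+_ (countLess-swapAt x k (y ∷ w)) (inv-swapAt-ascent k (y ∷ w) k+1<n ascent)) (+-suc _ _)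
inv-swapAt-ascent zero    (x ∷ []) (s≤s ()) _
inv-swapAt-ascent (suc k) (x ∷ []) (s≤s ()) _

countLess-≤ : ∀ x w → countLess x w ≤ length w
countLess-≤ x []      = z≤n
countLess-≤ x (y ∷ w) with y <ᵇ x
... | true  = s≤s (countLess-≤ x w)
... | false = m≤n⇒m≤1+n (countLess-≤ x w)

inv≤length² : ∀ w → inv w ≤ length w * length w
inv≤length² []      = z≤n
inv≤length² (x ∷ w) =
  ≤-trans (+-mono-≤ (countLess-≤ x w) (inv≤length² w))
          (+-mono-≤ (n≤1+n (length w)) (*-monoʳ-≤ (length w) (n≤1+n (length w))))

fuel-exhausted : ∀ {B x y} → y ≡ suc x → y ≤ B → B ≤ 0 + x → ⊥
fuel-exhausted refl y≤B B≤x = <-irrefl refl (≤-trans y≤B B≤x)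

fuel-step : ∀ {B f x y} → y ≡ suc x → B ≤ suc f + x → B ≤ f + y
fuel-step {B} {f} {x} refl B≤ = subst (B ≤_) (sym (+-suc f x)) B≤

-- J-blocks and parabolic subgroups

stepwise : (R : ℕ → ℕ → Set) → (∀ {a b c} → R a b → R b c → R a c) →
           ∀ {p q} → (∀ k → p ≤ k → k < q → R k (suc k)) → p < q → R p q
stepwise R R-trans {p} {suc q} step p<q+1 with m<1+n⇒m<n∨m≡n p<q+1
... | inj₂ refl = step p ≤-refl (n<1+n p)
... | inj₁ p<q  = R-trans (stepwise R R-trans (λ k p≤k k<q → step k p≤k (m<n⇒m<1+n k<q)) p<q)
                          (step q (<⇒≤ p<q) (n<1+n q))

stepwise-≤ : (f : ℕ → ℕ) → (∀ k → f k ≤ f (suc k)) → ∀ {p q} → p ≤ q → f p ≤ f q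
stepwise-≤ f step p≤q with m≤n⇒m<n∨m≡n p≤q
... | inj₁ p<q  = stepwise (λ a b → f a ≤ f b) ≤-trans (λ k _ _ → step k) p<q
... | inj₂ refl = ≤-refl

-- Index k stands for the generator s_{k+1}; false beyond the range of J.
contains : ∀ {n} → Subset n → ℕ → Bool
contains []      k       = false
contains (b ∷ J) zero    = b
contains (b ∷ J) (suc k) = contains J k

contains-∈ : ∀ {n} (J : Subset n) {i} → i Sub.∈ J → contains J (toℕ i) ≡ true
contains-∈ (b ∷ J) here       = refl
contains-∈ (b ∷ J) (there i∈J) = contains-∈ J i∈J

∈-contains : ∀ {n} (J : Subset n) k → contains J k ≡ true → ∃ λ (i : Fin n) → toℕ i ≡ k × i Sub.∈ J
∈-contains (true ∷ J)  zero    _ = Fin.zero , refl , here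
∈-contains (b ∷ J)     (suc k) k∈J with ∈-contains J k k∈J
... | i , refl , i∈J = Fin.suc i , refl , there i∈J

contains-< : ∀ {n} (J : Subset n) k → contains J k ≡ true → k < n
contains-< (b ∷ J) zero    _   = z<s
contains-< (b ∷ J) (suc k) k∈J = s≤s (contains-< J k k∈J)

contains-injective : ∀ {n} (J J′ : Subset n) → (∀ k → k < n → contains J k ≡ contains J′ k) → J ≡ J′
contains-injective []      []        _    = refl
contains-injective (b ∷ J) (b′ ∷ J′) same =
  cong₂ _∷_ (same zero z<s) (contains-injective J J′ (λ k k<n → same (suc k) (s≤s k<n)))

-- Numbers the J-blocks: the maximal runs of positions i, i+1, … joined by members of J.
block : ∀ {n} → Subset n → ℕ → ℕ
block J zero    = 0
block J (suc i) = if contains J i then block J i else suc (block J i)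

module _ {n} (J : Subset n) where

  block-∈ : ∀ i → contains J i ≡ true → block J (suc i) ≡ block J i
  block-∈ i i∈J rewrite i∈J = refl

  block-∉ : ∀ i → contains J i ≡ false → block J (suc i) ≡ suc (block J i)
  block-∉ i i∉J rewrite i∉J = refl

  block-mono : ∀ {i j} → i ≤ j → block J i ≤ block J j
  block-mono = stepwise-≤ (block J) step
    where
    step : ∀ i → block J i ≤ block J (suc i)
    step i with contains J i
    ... | true  = ≤-refl
    ... | false = n≤1+n _

  block-<⇒< : ∀ {i j} → block J i < block J j → i < j
  block-<⇒< {i} {j} bi<bj = ≰⇒> (λ j≤i → <⇒≱ bi<bj (block-mono j≤i))

  sameBlock⇒contains : ∀ {p q} k → p ≤ k → k < q → block J p ≡ block J q → contains J k ≡ true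
  sameBlock⇒contains {p} {q} k p≤k k<q same with contains J k in k∈?J
  ... | true  = refl
  ... | false = ⊥-elim (<⇒≱ jump (subst (block J (suc k) ≤_) (sym same) (block-mono k<q)))
    where
    jump : block J p < block J (suc k)
    jump = ≤-trans (s≤s (block-mono p≤k)) (≤-reflexive (sym (block-∉ k k∈?J)))

  sameBlock-stepwise : ∀ {M} (R : ℕ → ℕ → Set) → (∀ {a b c} → R a b → R b c → R a c) →
                       (∀ k → suc k < M → contains J k ≡ true → R k (suc k)) →
                       ∀ {p q} → p < q → q < M → block J p ≡ block J q → R p q
  sameBlock-stepwise R R-trans step p<q q<M same =
    stepwise R R-trans (λ k p≤k k<q → step k (≤-<-trans k<q q<M) (sameBlock⇒contains k p≤k k<q same)) p<q

pred-< : ∀ {x y} → 1 ≤ x → x < y → x ∸ 1 < y ∸ 1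
pred-< {suc x} {suc y} _ (s≤s x<y) = x<y

pred-<⁻¹ : ∀ {x y} → 1 ≤ x → x ∸ 1 < y ∸ 1 → x < y
pred-<⁻¹ {suc x} {suc y} _ x<y = s≤s x<y

pred< : ∀ {x M} → 1 ≤ x → x ≤ M → x ∸ 1 < M
pred< {suc x} _ x<M = x<M

<pred⇒suc< : ∀ {k} M → k < M ∸ 1 → suc k < M
<pred⇒suc< (suc M) k<M = s≤s k<M

suc<⇒<pred : ∀ {k} M → suc k < M → k < M ∸ 1
suc<⇒<pred (suc M) (s≤s k<M) = k<M

-- Every element of the parabolic subgroup W_J permutes [M] and maps each J-block onto itself;
-- among such permutations, w₀(J) is the unique one without ascents inside a block.
module Parabolic (M : ℕ) (J : Subset (M ∸ 1)) where

  record BlockPreserving (w : List ℕ) : Set where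
    field
      length≡  : length w ≡ M
      distinct : Distinct w
      range    : ∀ i → i < M → 1 ≤ nth w i × nth w i ≤ M
      block≡   : ∀ i → i < M → block J (nth w i ∸ 1) ≡ block J i
      onto     : ∀ v → 1 ≤ v → v ≤ M → Occurs v w
  open BlockPreserving public

  JAscentAt : List ℕ → ℕ → Set
  JAscentAt w k = suc k < M × contains J k ≡ true × nth w k < nth w (suc k)

  NoJAscent : List ℕ → Set
  NoJAscent w = ∀ k → ¬ JAscentAt w k

  AscentStep : List ℕ → List ℕ → Set
  AscentStep w w′ = ∃ λ k → JAscentAt w k × w′ ≡ swapAt k w

  blockPreserving-id : BlockPreserving (idPerm M)
  blockPreserving-id = record
    { length≡  = length-idPerm M
    ; distinct = λ i j i<n j<n same →
        suc-injective (trans (sym (nth-idPerm (<M i<n))) (trans same (nth-idPerm (<M j<n))))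
    ; range    = λ i i<M → subst (λ v → 1 ≤ v × v ≤ M) (sym (nth-idPerm i<M)) (s≤s z≤n , i<M)
    ; block≡   = λ i i<M → cong (λ v → block J (v ∸ 1)) (nth-idPerm i<M)
    ; onto     = λ { (suc v) _ v<M → v , subst (v <_) (sym (length-idPerm M)) v<M , nth-idPerm v<M }
    }
    where
    <M : ∀ {i} → i < length (idPerm M) → i < M
    <M = subst (_ <_) (length-idPerm M)

  block-swapIndex : ∀ k i → contains J k ≡ true → block J (swapIndex k i) ≡ block J i
  block-swapIndex k i k∈J with i ≟ k
  ... | yes refl = block-∈ J k k∈J
  ... | no _ with i ≟ suc k
  ...   | yes refl = sym (block-∈ J k k∈J)
  ...   | no _     = refl

  blockPreserving-swapAt : ∀ {w} k → suc k < M → contains J k ≡ true →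
                           BlockPreserving w → BlockPreserving (swapAt k w)
  blockPreserving-swapAt {w} k k+1<M k∈J bp = record
    { length≡  = trans (length-swapAt k w) (length≡ bp)
    ; distinct = distinct-swapAt k w k+1<n (distinct bp)
    ; range    = λ i i<M → subst (λ v → 1 ≤ v × v ≤ M) (sym (nth-swapAt k w i k+1<n))
                                 (range bp (swapIndex k i) (swapIndex-< i k+1<M i<M))
    ; block≡   = λ i i<M → trans (cong (λ v → block J (v ∸ 1)) (nth-swapAt k w i k+1<n))
                           (trans (block≡ bp (swapIndex k i) (swapIndex-< i k+1<M i<M)) (block-swapIndex k i k∈J))
    ; onto     = λ v 1≤v v≤M → occurs-swapAt k w k+1<n (onto bp v 1≤v v≤M)
    }
    where
    k+1<n = subst (suc k <_) (sym (length≡ bp)) k+1<M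

  genStep⇒blockPreserving : ∀ {w w′} → Star (GenStep M J) w w′ → BlockPreserving w → BlockPreserving w′
  genStep⇒blockPreserving ε                          bp = bp
  genStep⇒blockPreserving ((i , i∈J , refl) ◅ steps) bp =
    genStep⇒blockPreserving steps
      (blockPreserving-swapAt (toℕ i) (<pred⇒suc< M (toℕ<n i)) (contains-∈ J i∈J) bp)

  inParabolic⇒blockPreserving : ∀ {w} → InParabolic M J w → BlockPreserving w
  inParabolic⇒blockPreserving par = genStep⇒blockPreserving par blockPreserving-id

  ascentStep⇒genStep : ∀ {w w′} → AscentStep w w′ → GenStep M J w w′
  ascentStep⇒genStep {w} (k , (k+1<M , k∈J , _) , refl) with ∈-contains J k k∈J
  ... | i , refl , i∈J = i , i∈J , refl

  ascent? : ∀ w → (∃ λ k → JAscentAt w k) ⊎ NoJAscent w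
  ascent? w with anyUpTo? (λ k → (suc k <? M) ×-dec (contains J k Bool.≟ true) ×-dec (nth w k <? nth w (suc k))) M
  ... | yes (k , _ , ascent) = inj₁ (k , ascent)
  ... | no none = inj₂ λ k ascent → none (k , <-trans (n<1+n k) (proj₁ ascent) , ascent)

  inv-ascentStep : ∀ {w w′} → BlockPreserving w → AscentStep w w′ → inv w′ ≡ suc (inv w)
  inv-ascentStep {w} bp (k , (k+1<M , _ , ascent) , refl) =
    inv-swapAt-ascent k w (subst (suc k <_) (sym (length≡ bp)) k+1<M) ascent

  ClimbsTo : List ℕ → Set
  ClimbsTo w = ∃ λ v → Star AscentStep w v × inv w ≤ inv v × NoJAscent v × BlockPreserving v

  -- Fuel M² suffices: each ascent step raises inv by one, and inv ≤ M².
  climb : ∀ fuel w → BlockPreserving w → M * M ≤ fuel + inv w → ClimbsTo w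
  climb fuel w bp bound with ascent? w
  ... | inj₂ top = w , ε , ≤-refl , top , bp
  ... | inj₁ (k , ascent@(k+1<M , k∈J , _)) = step fuel bound
    where
    bp′ = blockPreserving-swapAt k k+1<M k∈J bp
    inv-up = inv-ascentStep bp (k , ascent , refl)
    step : ∀ fuel → M * M ≤ fuel + inv w → ClimbsTo w
    step zero       bound = ⊥-elim (fuel-exhausted inv-up inv≤M² bound)
      where inv≤M² = subst (λ l → inv (swapAt k w) ≤ l * l) (length≡ bp′) (inv≤length² (swapAt k w))
    step (suc fuel) bound with climb fuel (swapAt k w) bp′ (fuel-step inv-up bound)
    ... | v , path , inv≤ , top , bpv =
      v , (k , ascent , refl) ◅ path , ≤-trans (n≤1+n _) (subst (_≤ inv v) inv-up inv≤) , top , bpv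

  module _ {w : List ℕ} (bp : BlockPreserving w) where

    private
      <n : ∀ {i} → i < M → i < length w
      <n = subst (_ <_) (sym (length≡ bp))

    differentBlocks⇒increasing : ∀ {i j} → i < M → j < M → block J i < block J j → nth w i < nth w j
    differentBlocks⇒increasing {i} {j} i<M j<M b< =
      pred-<⁻¹ (proj₁ (range bp i i<M))
               (block-<⇒< J (subst₂ _<_ (sym (block≡ bp i i<M)) (sym (block≡ bp j j<M)) b<))

    differentBlocks⇒precedes : ∀ {p q} → p < M → q < M → block J p < block J q → Precedes w (suc p) (suc q)
    differentBlocks⇒precedes p<M q<M b< with onto bp (suc _) (s≤s z≤n) p<M | onto bp (suc _) (s≤s z≤n) q<M
    ... | a , a<n , wa | b , b<n , wb =
      a , b , block-<⇒< J (subst₂ _<_ (block-position a a<n wa) (block-position b b<n wb) b<) , b<n , wa , wb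
      where
      block-position : ∀ {v} a → a < length w → nth w a ≡ suc v → block J v ≡ block J a
      block-position a a<n wa =
        trans (cong (λ x → block J (x ∸ 1)) (sym wa)) (block≡ bp a (subst (a <_) (length≡ bp) a<n))

    module _ (top : NoJAscent w) where

      J-descent : ∀ k → suc k < M → contains J k ≡ true → nth w (suc k) < nth w k
      J-descent k k+1<M k∈J with <-cmp (nth w k) (nth w (suc k))
      ... | tri< ascent _ _ = ⊥-elim (top k (k+1<M , k∈J , ascent))
      ... | tri≈ _ same _   =
        ⊥-elim (1+n≢n (sym (distinct bp k (suc k) (<n (<-trans (n<1+n k) k+1<M)) (<n k+1<M) same)))
      ... | tri> _ _ descent = descent

      sameBlock⇒decreasing : ∀ {i j} → i < j → j < M → block J i ≡ block J j → nth w j < nth w i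
      sameBlock⇒decreasing = sameBlock-stepwise J (λ a b → nth w b < nth w a) (λ ab bc → <-trans bc ab) J-descent

      sameBlock⇒reversed : ∀ {p q} → p < q → q < M → block J p ≡ block J q → Precedes w (suc q) (suc p)
      sameBlock⇒reversed {p} {q} p<q q<M same
        with onto bp (suc q) (s≤s z≤n) q<M | onto bp (suc p) (s≤s z≤n) (<-trans p<q q<M)
      ... | a , a<n , wa | b , b<n , wb with <-cmp a b
      ...   | tri< a<b _ _ = a , b , a<b , b<n , wa , wb
      ...   | tri≈ _ refl _ = ⊥-elim (<-irrefl (suc-injective (trans (sym wb) wa)) p<q)
      ...   | tri> _ _ b<a = ⊥-elim (<-asym (s≤s p<q) (subst₂ _<_ wa wb (sameBlock⇒decreasing b<a a<M blocks)))
        where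
        a<M = subst (a <_) (length≡ bp) a<n
        b<M = subst (b <_) (length≡ bp) b<n
        blocks : block J b ≡ block J a
        blocks = trans (sym (block≡ bp b b<M)) (trans (cong (λ x → block J (x ∸ 1)) wb)
                   (trans same (trans (sym (cong (λ x → block J (x ∸ 1)) wa)) (block≡ bp a a<M))))

  -- Both u and v decrease inside each block and increase across blocks, so consecutive
  -- entries of u occur in the same order in v.
  noJAscent-unique : ∀ {u v} → BlockPreserving u → NoJAscent u → BlockPreserving v → NoJAscent v → u ≡ v
  noJAscent-unique {u} {v} bu tu bv tv =
    consecutive-precedes⇒≡ (distinct bv) (trans (length≡ bu) (sym (length≡ bv))) consecutive occurs
    where
    occurs : ∀ i → i < length u → Occurs (nth u i) v
    occurs i i<n = onto bv (nth u i) (proj₁ (range bu i i<M)) (proj₂ (range bu i i<M))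
      where i<M = subst (i <_) (length≡ bu) i<n
    consecutive : ∀ k → suc k < length u → Precedes v (nth u k) (nth u (suc k))
    consecutive k k+1<n with occurs k (<-trans (n<1+n k) k+1<n) | occurs (suc k) k+1<n
    ... | a , a<n , va | b , b<n , vb = a , b , a<b , b<n , va , vb
      where
      k+1<M = subst (suc k <_) (length≡ bu) k+1<n
      a<M = subst (a <_) (length≡ bv) a<n
      b<M = subst (b <_) (length≡ bv) b<n
      block-a : block J a ≡ block J k
      block-a = trans (sym (block≡ bv a a<M))
                      (trans (cong (λ x → block J (x ∸ 1)) va) (block≡ bu k (<-trans (n<1+n k) k+1<M)))
      block-b : block J b ≡ block J (suc k)
      block-b = trans (sym (block≡ bv b b<M))
                      (trans (cong (λ x → block J (x ∸ 1)) vb) (block≡ bu (suc k) k+1<M))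
      a<b : a < b
      a<b with contains J k in k∈?J
      ... | false = block-<⇒< J (subst₂ _<_ (sym block-a) (sym block-b) (≤-reflexive (sym (block-∉ J k k∈?J))))
      ... | true with <-cmp a b
      ...   | tri< a<b _ _  = a<b
      ...   | tri≈ _ refl _ = ⊥-elim (<-irrefl (trans (sym vb) va) (J-descent bu tu k k+1<M k∈?J))
      ...   | tri> _ _ b<a  = ⊥-elim (<-asym (J-descent bu tu k k+1<M k∈?J)
                 (subst₂ _<_ va vb (sameBlock⇒decreasing bv tv b<a a<M
                   (trans block-b (trans (block-∈ J k k∈?J) (sym block-a))))))

  private
    top : ClimbsTo (idPerm M)
    top = climb (M * M) (idPerm M) blockPreserving-id (m≤m+n (M * M) _)

  w₀ : List ℕ
  w₀ = proj₁ top

  w₀-path : Star AscentStep (idPerm M) w₀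
  w₀-path = proj₁ (proj₂ top)

  w₀-noJAscent : NoJAscent w₀
  w₀-noJAscent = proj₁ (proj₂ (proj₂ (proj₂ top)))

  w₀-blockPreserving : BlockPreserving w₀
  w₀-blockPreserving = proj₂ (proj₂ (proj₂ (proj₂ top)))

  w₀-pred< : ∀ {i} → i < M → nth w₀ i ∸ 1 < M
  w₀-pred< i<M = pred< (proj₁ (range w₀-blockPreserving _ i<M)) (proj₂ (range w₀-blockPreserving _ i<M))

  isW0⇒noJAscent : ∀ {w} → IsW0 M J w → NoJAscent w
  isW0⇒noJAscent {w} (par , longest) k ascent =
    <⇒≱ (subst (inv w <_) (sym (inv-ascentStep bp step)) ≤-refl)
        (longest (swapAt k w) (par ◅◅ ascentStep⇒genStep step ◅ ε))
    where
    bp = inParabolic⇒blockPreserving par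
    step = (k , ascent , refl)

  isW0⇒≡w₀ : ∀ {w} → IsW0 M J w → w ≡ w₀
  isW0⇒≡w₀ isW0 = noJAscent-unique (inParabolic⇒blockPreserving (proj₁ isW0)) (isW0⇒noJAscent isW0)
                                   w₀-blockPreserving w₀-noJAscent

  w₀-isW0 : IsW0 M J w₀
  w₀-isW0 = Star.map ascentStep⇒genStep w₀-path , longest
    where
    longest : ∀ w → InParabolic M J w → inv w ≤ inv w₀
    longest w par with climb (M * M) w bp (m≤m+n (M * M) _)
      where bp = inParabolic⇒blockPreserving par
    ... | v , _ , inv≤ , tv , bv =
      subst (λ u → inv w ≤ inv u) (noJAscent-unique bv tv w₀-blockPreserving w₀-noJAscent) inv≤

  contains-w₀-descent : ∀ k → suc k < M → contains J k ≡ (nth w₀ (suc k) <ᵇ nth w₀ k)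
  contains-w₀-descent k k+1<M with contains J k in k∈?J
  ... | true  = sym (<ᵇ-true (J-descent w₀-blockPreserving w₀-noJAscent k k+1<M k∈?J))
  ... | false = sym (<ᵇ-false (<-asym (differentBlocks⇒increasing w₀-blockPreserving (<-trans (n<1+n k) k+1<M) k+1<M
                                        (≤-reflexive (sym (block-∉ J k k∈?J))))))

w₀-injective : ∀ M (J J′ : Subset (M ∸ 1)) → Parabolic.w₀ M J ≡ Parabolic.w₀ M J′ → J ≡ J′
w₀-injective M J J′ same = contains-injective J J′ λ k k<M-1 →
  trans (Parabolic.contains-w₀-descent M J k (<pred⇒suc< M k<M-1))
        (trans (cong (λ w → nth w (suc k) <ᵇ nth w k) same)
               (sym (Parabolic.contains-w₀-descent M J′ k (<pred⇒suc< M k<M-1))))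

-- Multiset words and standardization

count : ℕ → List ℕ → ℕ
count a xs = length (filter (a ≟_) xs)

count-here : ∀ {a x} xs → a ≡ x → count a (x ∷ xs) ≡ suc (count a xs)
count-here xs a≡x = cong length (filter-accept (_ ≟_) a≡x)

count-there : ∀ {a x} xs → a ≢ x → count a (x ∷ xs) ≡ count a xs
count-there xs a≢x = cong length (filter-reject (_ ≟_) a≢x)

count-++ : ∀ a xs ys → count a (xs ++ ys) ≡ count a xs + count a ys
count-++ a xs ys = trans (cong length (filter-++ (a ≟_) xs ys)) (length-++ (filter (a ≟_) xs))

count-↭ : ∀ a {xs ys} → xs ↭ ys → count a xs ≡ count a ys
count-↭ a xs↭ys = ↭-length (filter-↭ (a ≟_) xs↭ys)

count-replicate-self : ∀ a x → count a (replicate x a) ≡ x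
count-replicate-self a zero    = refl
count-replicate-self a (suc x) = trans (count-here {a} _ refl) (cong suc (count-replicate-self a x))

count-replicate-other : ∀ {a k} x → a ≢ k → count a (replicate x k) ≡ 0
count-replicate-other zero    a≢k = refl
count-replicate-other (suc x) a≢k = trans (count-there _ a≢k) (count-replicate-other x a≢k)

count-msetFrom-< : ∀ {a k} ms → a < k → count a (msetFrom k ms) ≡ 0
count-msetFrom-< []       a<k = refl
count-msetFrom-< (x ∷ ms) a<k =
  trans (count-++ _ (replicate x _) _)
        (cong₂ _+_ (count-replicate-other x (<⇒≢ a<k)) (count-msetFrom-< ms (m<n⇒m<1+n a<k)))

count-msetFrom : ∀ k i ms → count (k + i) (msetFrom k ms) ≡ nth ms i
count-msetFrom k i       []       = nth-[] i
  where
  nth-[] : ∀ i → 0 ≡ nth [] i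
  nth-[] zero    = refl
  nth-[] (suc i) = refl
count-msetFrom k zero    (x ∷ ms) rewrite +-identityʳ k =
  trans (count-++ k (replicate x k) _)
        (trans (cong₂ _+_ (count-replicate-self k x) (count-msetFrom-< ms (n<1+n k))) (+-identityʳ x))
count-msetFrom k (suc i) (x ∷ ms) =
  trans (count-++ (k + suc i) (replicate x k) _)
        (cong₂ _+_ (count-replicate-other x (m+1+n≢m k))
                   (trans (cong (λ a → count a (msetFrom (suc k) ms)) (+-suc k i)) (count-msetFrom (suc k) i ms)))

∈-msetFrom : ∀ x k ms → x ∈ msetFrom k ms → k ≤ x × x < k + length ms
∈-msetFrom x k (y ∷ ms) x∈ with ∈-++⁻ (replicate y k) x∈
... | inj₁ x∈rep = subst (λ x → k ≤ x × x < k + length (y ∷ ms)) (sym (∈-replicate x∈rep))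
                         (≤-refl , subst (k <_) (sym (+-suc k (length ms))) (s≤s (m≤m+n k _)))
  where
  ∈-replicate : ∀ {n z} → z ∈ replicate n k → z ≡ k
  ∈-replicate {suc n} (here z≡k)  = z≡k
  ∈-replicate {suc n} (there z∈) = ∈-replicate z∈
... | inj₂ x∈rest with ∈-msetFrom x (suc k) ms x∈rest
...   | k<x , x<k+1+n = <⇒≤ k<x , subst (x <_) (sym (+-suc k (length ms))) x<k+1+n

length-msetFrom : ∀ k ms → length (msetFrom k ms) ≡ totalM ms
length-msetFrom k []       = refl
length-msetFrom k (x ∷ ms) =
  trans (length-++ (replicate x k)) (cong₂ _+_ (length-replicate x) (length-msetFrom (suc k) ms))

nth-∈ : ∀ u {p} → p < length u → nth u p ∈ u
nth-∈ (x ∷ u) {zero}  _         = here refl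
nth-∈ (x ∷ u) {suc p} (s≤s p<n) = there (nth-∈ u p<n)

count-take-suc : ∀ u p → p < length u → count (nth u p) (take (suc p) u) ≡ suc (count (nth u p) (take p u))
count-take-suc (x ∷ u) zero    _         = count-here {x} [] refl
count-take-suc (x ∷ u) (suc p) (s≤s p<n) with nth u p ≟ x
... | yes e = trans (count-here _ e) (cong suc (trans (count-take-suc u p p<n) (sym (count-here _ e))))
... | no ne = trans (count-there _ ne) (trans (count-take-suc u p p<n) (cong suc (sym (count-there _ ne))))

count-take-mono : ∀ a u {p q} → p ≤ q → count a (take p u) ≤ count a (take q u)
count-take-mono a []      {p} {q} _ rewrite take-[] {A = ℕ} p | take-[] {A = ℕ} q = ≤-refl
count-take-mono a (x ∷ u) {zero}          _         = z≤n
count-take-mono a (x ∷ u) {suc p} {suc q} (s≤s p≤q) with a ≟ x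
... | yes e = subst₂ _≤_ (sym (count-here _ e)) (sym (count-here _ e)) (s≤s (count-take-mono a u p≤q))
... | no ne = subst₂ _≤_ (sym (count-there _ ne)) (sym (count-there _ ne)) (count-take-mono a u p≤q)

count-take-≤ : ∀ a u p → count a (take p u) ≤ count a u
count-take-≤ a u p =
  subst (count a (take p u) ≤_) (cong (count a) (take-all (p + length u) u (m≤n+m _ p)))
        (count-take-mono a u (m≤m+n p _))

count-take-< : ∀ u p → p < length u → count (nth u p) (take p u) < count (nth u p) u
count-take-< u p p<n = subst (_≤ count (nth u p) u) (count-take-suc u p p<n) (count-take-≤ (nth u p) u (suc p))

occurrence : ∀ a u j → j < count a u → ∃ λ p → p < length u × nth u p ≡ a × count a (take p u) ≡ j
occurrence a (x ∷ u) j j<c with a ≟ x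
occurrence a (x ∷ u) zero    _   | yes refl = zero , z<s , refl , refl
occurrence a (x ∷ u) (suc j) j<c | yes refl
  with occurrence a u j (≤-pred (subst (suc j <_) (count-here u refl) j<c))
... | p , p<n , up , rank = suc p , s≤s p<n , up , trans (count-here (take p u) refl) (cong suc rank)
occurrence a (x ∷ u) j j<c | no a≢x with occurrence a u j (subst (j <_) (count-there u a≢x) j<c)
... | p , p<n , up , rank = suc p , s≤s p<n , up , trans (count-there (take p u) a≢x) rank

firstOcc-spec : ∀ a u → 0 < count a u →
                firstOcc a u < length u × nth u (firstOcc a u) ≡ a × count a (take (firstOcc a u) u) ≡ 0
firstOcc-spec a (x ∷ u) 0<c with x ≟ a
... | yes refl = z<s , refl , refl
... | no x≢a with firstOcc-spec a u (subst (0 <_) (count-there u (x≢a ∘ sym)) 0<c)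
...   | p<n , up , rank = s≤s p<n , up , trans (count-there (take (firstOcc a u) u) (x≢a ∘ sym)) rank

module _ (m : List ℕ) where

  stdz-cong : ∀ {c c′} w → (∀ i → c i ≡ c′ i) → stdz m c w ≡ stdz m c′ w
  stdz-cong             []      same = refl
  stdz-cong {c} {c′} (x ∷ w) same =
    cong₂ _∷_ (cong (λ z → partialSum m (x ∸ 1) + suc z) (same x)) (stdz-cong w update-same)
    where
    update-same : ∀ i → update c x i ≡ update c′ x i
    update-same i with i ≟ x
    ... | yes _ = cong suc (same i)
    ... | no _  = same i

  length-stdz : ∀ c w → length (stdz m c w) ≡ length w
  length-stdz c []      = refl
  length-stdz c (x ∷ w) = cong suc (length-stdz (update c x) w)

  nth-stdz : ∀ c u p → p < length u →
             nth (stdz m c u) p ≡ partialSum m (nth u p ∸ 1) + suc (c (nth u p) + count (nth u p) (take p u))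
  nth-stdz c (x ∷ u) zero    _         = cong (λ z → partialSum m (x ∸ 1) + suc z) (sym (+-identityʳ (c x)))
  nth-stdz c (x ∷ u) (suc p) (s≤s p<n) =
    trans (nth-stdz (update c x) u p p<n) (cong (λ z → partialSum m (nth u p ∸ 1) + suc z) (seen (nth u p)))
    where
    seen : ∀ y → update c x y + count y (take p u) ≡ c y + count y (x ∷ take p u)
    seen y with y ≟ x
    ... | yes y≡x = trans (sym (+-suc (c y) _)) (cong (c y +_) (sym (count-here _ y≡x)))
    ... | no y≢x  = cong (c y +_) (sym (count-there _ y≢x))

  stdz-swapAt : ∀ c k u → nth u k ≢ nth u (suc k) → stdz m c (swapAt k u) ≡ swapAt k (stdz m c u)
  stdz-swapAt c k       []          _ = refl
  stdz-swapAt c k       (x ∷ [])    _ = refl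
  stdz-swapAt c zero    (x ∷ y ∷ w) x≢y =
    cong₂ _∷_ (cong (λ z → partialSum m (y ∸ 1) + suc z) (sym (update-other y x (x≢y ∘ sym))))
      (cong₂ _∷_ (cong (λ z → partialSum m (x ∸ 1) + suc z) (update-other x y x≢y))
        (stdz-cong w update-comm))
    where
    update-other : ∀ a b → a ≢ b → update c b a ≡ c a
    update-other a b a≢b with a ≟ b
    ... | yes a≡b = ⊥-elim (a≢b a≡b)
    ... | no _    = refl
    update-comm : ∀ i → update (update c y) x i ≡ update (update c x) y i
    update-comm i with i ≟ x | i ≟ y
    ... | yes refl | yes refl = ⊥-elim (x≢y refl)
    ... | yes refl | no _     = refl
    ... | no _     | yes refl = refl
    ... | no _     | no _     = refl
  stdz-swapAt c (suc k) (x ∷ y ∷ w) x≢y = cong (_ ∷_) (stdz-swapAt (update c x) k (y ∷ w) x≢y)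

partialSum-suc : ∀ m i → partialSum m (suc i) ≡ partialSum m i + nth m i
partialSum-suc []      zero    = refl
partialSum-suc []      (suc i) = refl
partialSum-suc (x ∷ m) zero    = +-comm x 0
partialSum-suc (x ∷ m) (suc i) = trans (cong (x +_) (partialSum-suc m i)) (sym (+-assoc x _ _))

partialSum-mono : ∀ m {i j} → i ≤ j → partialSum m i ≤ partialSum m j
partialSum-mono m = stepwise-≤ (partialSum m) λ i →
  subst (partialSum m i ≤_) (sym (partialSum-suc m i)) (m≤m+n _ _)

All-nth : ∀ {P : ℕ → Set} {m} → All P m → ∀ {i} → i < length m → P (nth m i)
All-nth (p ∷ _)  {zero}  _         = p
All-nth (_ ∷ ps) {suc i} (s≤s i<n) = All-nth ps i<n

module Words (m : List ℕ) where

  M : ℕ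
  M = totalM m

  n : ℕ
  n = length m

  IsWord : List ℕ → Set
  IsWord u = u ↭ mset m

  σ : List ℕ → List ℕ
  σ = toPerm m

  multiplicity : ℕ → ℕ
  multiplicity a = nth m (a ∸ 1)

  -- the value M_{a-1} + j + 1 given to the (j+1)-th occurrence of the label a
  entry : ℕ → ℕ → ℕ
  entry a j = partialSum m (a ∸ 1) + suc j

  word-length : ∀ {u} → IsWord u → length u ≡ M
  word-length w = trans (↭-length w) (length-msetFrom 1 m)

  word-count : ∀ {u} → IsWord u → ∀ a → 1 ≤ a → count a u ≡ multiplicity a
  word-count w (suc a) _ = trans (count-↭ (suc a) w) (count-msetFrom 1 a m)

  word-label : ∀ {u} → IsWord u → ∀ p → p < length u → 1 ≤ nth u p × nth u p ≤ n
  word-label {u} w p p<n with ∈-msetFrom (nth u p) 1 m (∈-resp-↭ w (nth-∈ u p<n))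
  ... | 1≤a , s≤s a≤n = 1≤a , a≤n

  σ-length : ∀ u → length (σ u) ≡ length u
  σ-length = length-stdz m (λ _ → 0)

  nth-σ : ∀ u p → p < length u → nth (σ u) p ≡ entry (nth u p) (count (nth u p) (take p u))
  nth-σ = nth-stdz m (λ _ → 0)

  rank<multiplicity : ∀ {u} → IsWord u → ∀ p → p < length u →
                      count (nth u p) (take p u) < multiplicity (nth u p)
  rank<multiplicity {u} w p p<n =
    subst (count (nth u p) (take p u) <_) (word-count w (nth u p) (proj₁ (word-label w p p<n)))
          (count-take-< u p p<n)

  entry-< : ∀ {a b j k} → 1 ≤ a → a < b → j < multiplicity a → entry a j < entry b k
  entry-< {suc a} {suc b} {j} _ (s≤s a<b) j<ma =
    ≤-<-trans (≤-trans (+-monoʳ-≤ (partialSum m a) j<ma) (≤-reflexive (sym (partialSum-suc m a))))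
              (≤-<-trans (partialSum-mono m a<b) (m<m+n _ z<s))

  entry-injective : ∀ {a b j k} → 1 ≤ a → 1 ≤ b → j < multiplicity a → k < multiplicity b →
                    entry a j ≡ entry b k → a ≡ b
  entry-injective 1≤a 1≤b j<ma k<mb same with <-cmp _ _
  ... | tri< a<b _ _ = ⊥-elim (<-irrefl same (entry-< 1≤a a<b j<ma))
  ... | tri≈ _ a≡b _ = a≡b
  ... | tri> _ _ b<a = ⊥-elim (<-irrefl (sym same) (entry-< 1≤b b<a k<mb))

  σ-swapAt : ∀ u k → nth u k ≢ nth u (suc k) → σ (swapAt k u) ≡ swapAt k (σ u)
  σ-swapAt u k = stdz-swapAt m (λ _ → 0) k u

  module _ {u : List ℕ} (w : IsWord u) where

    σ-label-ascent : ∀ {p q} → p < length u → q < length u → nth u p < nth u q → nth (σ u) p < nth (σ u) q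
    σ-label-ascent {p} {q} p<n q<n up<uq = subst₂ _<_ (sym (nth-σ u p p<n)) (sym (nth-σ u q q<n))
      (entry-< (proj₁ (word-label w p p<n)) up<uq (rank<multiplicity w p p<n))

    σ-repeat-ascent : ∀ {p q} → p < q → q < length u → nth u p ≡ nth u q → nth (σ u) p < nth (σ u) q
    σ-repeat-ascent {p} {q} p<q q<n up≡uq = subst₂ _<_ (sym (nth-σ u p p<n)) (sym (nth-σ u q q<n))
      (subst (λ a → entry (nth u p) (count (nth u p) (take p u)) < entry a (count a (take q u))) up≡uq
        (+-monoʳ-< (partialSum m (nth u p ∸ 1))
          (s≤s (subst (_≤ count (nth u p) (take q u)) (count-take-suc u p p<n)
                      (count-take-mono (nth u p) u p<q)))))
      where p<n = <-trans p<q q<n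

    σ-ascent⇒ : ∀ {p q} → p < length u → q < length u → nth (σ u) p < nth (σ u) q →
                nth u p < nth u q ⊎ (nth u p ≡ nth u q × p < q)
    σ-ascent⇒ {p} {q} p<n q<n σp<σq with <-cmp (nth u p) (nth u q)
    ... | tri< up<uq _ _ = inj₁ up<uq
    ... | tri> _ _ uq<up = ⊥-elim (<-asym σp<σq (σ-label-ascent q<n p<n uq<up))
    ... | tri≈ _ up≡uq _ with <-cmp p q
    ...   | tri< p<q _ _  = inj₂ (up≡uq , p<q)
    ...   | tri≈ _ refl _ = ⊥-elim (<-irrefl refl σp<σq)
    ...   | tri> _ _ q<p  = ⊥-elim (<-asym σp<σq (σ-repeat-ascent q<p p<n (sym up≡uq)))

    σ-entries-differ : ∀ {i j} → i < j → j < length u → nth (σ u) i ≢ nth (σ u) j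
    σ-entries-differ {i} {j} i<j j<n same with <-cmp (nth u i) (nth u j)
    ... | tri< ui<uj _ _ = <-irrefl same (σ-label-ascent (<-trans i<j j<n) j<n ui<uj)
    ... | tri≈ _ ui≡uj _ = <-irrefl same (σ-repeat-ascent i<j j<n ui≡uj)
    ... | tri> _ _ uj<ui = <-irrefl (sym same) (σ-label-ascent j<n (<-trans i<j j<n) uj<ui)

    σ-distinct : Distinct (σ u)
    σ-distinct i j i<n j<n same with <-cmp i j
    ... | tri≈ _ i≡j _ = i≡j
    ... | tri< i<j _ _ = ⊥-elim (σ-entries-differ i<j (subst (j <_) (σ-length u) j<n) same)
    ... | tri> _ _ j<i = ⊥-elim (σ-entries-differ j<i (subst (i <_) (σ-length u) i<n) (sym same))

  module _ {u t : List ℕ} (wu : IsWord u) (wt : IsWord t) where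

    σ-label : ∀ {p q} → p < length u → q < length t → nth (σ u) p ≡ nth (σ t) q → nth u p ≡ nth t q
    σ-label {p} {q} p<n q<n same =
      entry-injective (proj₁ (word-label wu p p<n)) (proj₁ (word-label wt q q<n))
        (rank<multiplicity wu p p<n) (rank<multiplicity wt q q<n)
        (trans (sym (nth-σ u p p<n)) (trans same (nth-σ t q q<n)))

    σ-occurs : ∀ p → p < length u → Occurs (nth (σ u) p) (σ t)
    σ-occurs p p<n with occurrence (nth u p) t (count (nth u p) (take p u))
      (subst (count (nth u p) (take p u) <_) (sym (word-count wt (nth u p) (proj₁ (word-label wu p p<n))))
             (rank<multiplicity wu p p<n))
    ... | q , q<n , tq , rank = q , subst (q <_) (sym (σ-length t)) q<n ,
            trans (nth-σ t q q<n)
                  (trans (cong₂ entry tq (trans (cong (λ a → count a (take q t)) tq) rank)) (sym (nth-σ u p p<n)))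

    σ-injective : σ u ≡ σ t → u ≡ t
    σ-injective same = nth-ext same-length
      λ i i<n → σ-label i<n (subst (i <_) same-length i<n) (cong (λ π → nth π i) same)
      where same-length = trans (word-length wu) (sym (word-length wt))

  BLcond : List ℕ → Set
  BLcond u = ∀ i → 1 ≤ i → i < n → firstOcc i u < firstOcc (suc i) u

  module _ (positive : All (0 <_) m) where

    σ-firstOcc : ∀ {u} → IsWord u → ∀ a → 1 ≤ a → a ≤ n →
                 firstOcc a u < length u × nth u (firstOcc a u) ≡ a × nth (σ u) (firstOcc a u) ≡ entry a 0
    σ-firstOcc {u} w (suc a) _ a<n
      with firstOcc-spec (suc a) u (subst (0 <_) (sym (word-count w (suc a) (s≤s z≤n))) (All-nth positive a<n))
    ... | p<n , up , rank =
      p<n , up , trans (nth-σ u _ p<n)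
                       (cong₂ entry up (trans (cong (λ b → count b (take (firstOcc (suc a) u) u)) up) rank))

    -- The first occurrences of i and i+1 carry the values entry i 0 < entry (i+1) 0,
    -- so their relative order is an inversion of σ u exactly when BLcond fails at i.
    ⊆Inv⇒BLcond : ∀ {u t} → IsWord u → IsWord t → BLcond t → σ u ⊆Inv σ t → BLcond u
    ⊆Inv⇒BLcond {u} {t} wu wt bt u⊆t i 1≤i i<n
      with σ-firstOcc wu i 1≤i (<⇒≤ i<n) | σ-firstOcc wu (suc i) (s≤s z≤n) i<n
         | σ-firstOcc wt i 1≤i (<⇒≤ i<n) | σ-firstOcc wt (suc i) (s≤s z≤n) i<n
    ... | p<n , up , σup | q<n , uq , σuq | p′<n , _ , σtp | q′<n , _ , σtq
      with <-cmp (firstOcc i u) (firstOcc (suc i) u)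
    ...   | tri< p<q _ _  = p<q
    ...   | tri≈ _ p≡q _  = ⊥-elim (1+n≢n (trans (sym uq) (trans (sym (cong (nth u) p≡q)) up)))
    ...   | tri> _ _ q<p  =
      ⊥-elim (precedes-asym {σ t} (σ-distinct wt) in-t (u⊆t (entry i 0) (entry (suc i) 0) entries< in-u))
      where
      entries< : entry i 0 < entry (suc i) 0
      entries< = entry-< 1≤i (n<1+n i) (All-nth positive (≤-<-trans (m∸n≤m i 1) i<n))
      in-u : Precedes (σ u) (entry (suc i) 0) (entry i 0)
      in-u = firstOcc (suc i) u , firstOcc i u , q<p ,
             subst (firstOcc i u <_) (sym (σ-length u)) p<n , σuq , σup
      in-t : Precedes (σ t) (entry i 0) (entry (suc i) 0)
      in-t = firstOcc i t , firstOcc (suc i) t , bt i 1≤i i<n ,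
             subst (firstOcc (suc i) t <_) (sym (σ-length t)) q′<n , σtp , σtq

-- The order on barcodes

adjSwap⇒swapAt : ∀ {u v} → AdjSwap u v →
                 ∃ λ k → suc k < length u × nth u k < nth u (suc k) × v ≡ swapAt k u
adjSwap⇒swapAt (adjSwap []       ys a b a<b) = 0 , s≤s (s≤s z≤n) , a<b , refl
adjSwap⇒swapAt (adjSwap (x ∷ xs) ys a b a<b) with adjSwap⇒swapAt (adjSwap xs ys a b a<b)
... | k , k+1<n , ascent , v≡ = suc k , s≤s k+1<n , ascent , trans (cong (x ∷_) v≡) (sym (swapAt-suc x k _))

swapAt⇒adjSwap : ∀ k u → suc k < length u → nth u k < nth u (suc k) → AdjSwap u (swapAt k u)
swapAt⇒adjSwap zero    (a ∷ b ∷ w) _           a<b    = adjSwap [] w a b a<b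
swapAt⇒adjSwap (suc k) (x ∷ y ∷ w) (s≤s k+1<n) ascent = cons (swapAt⇒adjSwap k (y ∷ w) k+1<n ascent)
  where
  cons : ∀ {u v} → AdjSwap u v → AdjSwap (x ∷ u) (x ∷ v)
  cons (adjSwap xs ys a b a<b) = adjSwap (x ∷ xs) ys a b a<b
swapAt⇒adjSwap zero    (x ∷ [])    (s≤s ()) _
swapAt⇒adjSwap (suc k) (x ∷ [])    (s≤s ()) _

module BarcodeOrder (m : List ℕ) (positive : All (0 <_) m) where

  open Words m

  _≤B_ : List ℕ → List ℕ → Set
  u ≤B v = u ≤BL[ m ] v

  inv-BLStep : ∀ {u v} → BLStep m u v → inv v ≡ suc (inv u)
  inv-BLStep {u} (_ , _ , adj) with adjSwap⇒swapAt adj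
  ... | k , k+1<n , ascent , refl = inv-swapAt-ascent k u k+1<n ascent

  ≤B⇒≡⊎inv< : ∀ {u v} → u ≤B v → u ≡ v ⊎ inv u < inv v
  ≤B⇒≡⊎inv< ε = inj₁ refl
  ≤B⇒≡⊎inv< (step ◅ steps) with ≤B⇒≡⊎inv< steps
  ... | inj₁ refl = inj₂ (≤-reflexive (sym (inv-BLStep step)))
  ... | inj₂ lt   = inj₂ (<-trans (≤-reflexive (sym (inv-BLStep step))) lt)

  ≤B⇒inv≤ : ∀ {u v} → u ≤B v → inv u ≤ inv v
  ≤B⇒inv≤ u≤v = [ (λ { refl → ≤-refl }) , <⇒≤ ] (≤B⇒≡⊎inv< u≤v)

  ≤B-first-step : ∀ {u v} → u ≤B v → u ≢ v →
                  ∃ λ k → suc k < length u × nth u k < nth u (suc k) × swapAt k u ≤B v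
  ≤B-first-step ε                         u≢v = ⊥-elim (u≢v refl)
  ≤B-first-step ((_ , _ , adj) ◅ steps) _ with adjSwap⇒swapAt adj
  ... | k , k+1<n , ascent , refl = k , k+1<n , ascent , steps

  BL-target : ∀ {u v} → u ≤B v → BL m u → BL m v
  BL-target ε                    bu = bu
  BL-target ((_ , bv , _) ◅ steps) _  = BL-target steps bv

  BL-source : ∀ {u v} → u ≤B v → BL m v → BL m u
  BL-source ε                  bv = bv
  BL-source ((bu , _ , _) ◅ _) _  = bu

  word-swapAt : ∀ {u} k → IsWord u → IsWord (swapAt k u)
  word-swapAt k w = ↭-trans (swapAt-↭ k _) w

  σ-swapAt-ascent : ∀ {u} → IsWord u → ∀ k → suc k < length u → nth u k < nth u (suc k) →
                    σ (swapAt k u) ≡ swapAt k (σ u) × nth (σ u) k < nth (σ u) (suc k)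
  σ-swapAt-ascent w k k+1<n ascent =
    σ-swapAt _ k (<⇒≢ ascent) , σ-label-ascent w (<-trans (n<1+n k) k+1<n) k+1<n ascent

  ≤B⇒⊆Inv : ∀ {u v} → u ≤B v → σ u ⊆Inv σ v
  ≤B⇒⊆Inv ε _ _ _ = λ inversion → inversion
  ≤B⇒⊆Inv {u} {v} ((bu , _ , adj) ◅ steps) with adjSwap⇒swapAt adj
  ... | k , k+1<n , ascent , refl with σ-swapAt-ascent (proj₁ bu) k k+1<n ascent
  ...   | σ-swap , σ-ascent =
    ⊆Inv-trans {σ u} {σ (swapAt k u)} {σ v}
      (subst (σ u ⊆Inv_) (sym σ-swap) (⊆Inv-swapAt-ascent k (σ u) (subst (suc k <_) (sym (σ-length u)) k+1<n) σ-ascent))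
      (≤B⇒⊆Inv steps)

  inv≤M² : ∀ {u} → IsWord u → inv u ≤ M * M
  inv≤M² {u} w = subst (λ l → inv u ≤ l * l) (word-length w) (inv≤length² u)

  BL-swapAt : ∀ {u t} k → BL m u → BL m t → σ (swapAt k u) ⊆Inv σ t → BL m (swapAt k u)
  BL-swapAt k (wu , _) (wt , bt) inc = word-swapAt k wu , ⊆Inv⇒BLcond positive (word-swapAt k wu) wt bt inc

  ReversedAscent : List ℕ → List ℕ → ℕ → Set
  ReversedAscent u t k =
    suc k < length u × nth (σ u) k < nth (σ u) (suc k) × Precedes (σ t) (nth (σ u) (suc k)) (nth (σ u) k)

  reversedAscent? : ∀ u t k → Dec (ReversedAscent u t k)
  reversedAscent? u t k = (suc k <? length u) ×-dec (nth (σ u) k <? nth (σ u) (suc k)) ×-dec precedes? (σ t) _ _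

  -- Equal labels occur in σ u and in σ t in the same (left-to-right) order, so only a
  -- label ascent of u can be reversed in σ t.
  reversedAscent⇒ascent : ∀ {u t k} → IsWord u → IsWord t → ReversedAscent u t k → nth u k < nth u (suc k)
  reversedAscent⇒ascent {u} {t} {k} wu wt (k+1<n , σ-ascent , (a , b , a<b , b<n , σta , σtb))
    with σ-ascent⇒ wu (<-trans (n<1+n k) k+1<n) k+1<n σ-ascent
  ... | inj₁ ascent     = ascent
  ... | inj₂ (same , _) = ⊥-elim (<-asym σ-ascent (subst₂ _<_ σta σtb (σ-repeat-ascent wt a<b b<t ta≡tb)))
    where
    b<t = subst (b <_) (σ-length t) b<n
    ta≡tb : nth t a ≡ nth t b
    ta≡tb = trans (σ-label wt wu (<-trans a<b b<t) k+1<n σta)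
                  (trans (sym same) (sym (σ-label wt wu b<t (<-trans (n<1+n k) k+1<n) σtb)))

  noReversedAscent⇒≡ : ∀ {u t} → IsWord u → IsWord t → σ u ⊆Inv σ t →
                       (∀ k → ¬ ReversedAscent u t k) → u ≡ t
  noReversedAscent⇒≡ {u} {t} wu wt inc none =
    σ-injective wu wt (consecutive-precedes⇒≡ (σ-distinct wt) same-length consecutive occurs)
    where
    same-length = trans (σ-length u) (trans (word-length wu) (sym (trans (σ-length t) (word-length wt))))
    occurs : ∀ i → i < length (σ u) → Occurs (nth (σ u) i) (σ t)
    occurs i i<n = σ-occurs wu wt i (subst (i <_) (σ-length u) i<n)
    consecutive : ∀ k → suc k < length (σ u) → Precedes (σ t) (nth (σ u) k) (nth (σ u) (suc k))
    consecutive k k+1<n with <-cmp (nth (σ u) k) (nth (σ u) (suc k))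
    ... | tri≈ _ same _  = ⊥-elim (1+n≢n (sym (σ-distinct wu k (suc k) (<-trans (n<1+n k) k+1<n) k+1<n same)))
    ... | tri> _ _ desc  = inc _ _ desc (k , suc k , n<1+n k , k+1<n , refl , refl)
    ... | tri< ascent _ _
      with precedes-total {σ t} (occurs k (<-trans (n<1+n k) k+1<n)) (occurs (suc k) k+1<n) (<⇒≢ ascent)
    ...   | inj₁ in-order = in-order
    ...   | inj₂ reversed = ⊥-elim (none k (subst (suc k <_) (σ-length u) k+1<n , ascent , reversed))

  ⊆Inv⇒≤B : ∀ {u t} → BL m u → BL m t → σ u ⊆Inv σ t → u ≤B t
  ⊆Inv⇒≤B {u₀} {t} bu₀ bt inc₀ = go (M * M) u₀ bu₀ (m≤m+n (M * M) _) inc₀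
    where
    go : ∀ fuel u → BL m u → M * M ≤ fuel + inv u → σ u ⊆Inv σ t → u ≤B t
    go fuel u bu bound inc with anyUpTo? (reversedAscent? u t) (length u)
    ... | no none =
      subst (u ≤B_) (noReversedAscent⇒≡ (proj₁ bu) (proj₁ bt) inc λ k rev → none (k , <-trans (n<1+n k) (proj₁ rev) , rev)) ε
    ... | yes (k , _ , rev@(k+1<n , _ , reversed)) = step fuel bound
      where
      ascent = reversedAscent⇒ascent (proj₁ bu) (proj₁ bt) rev
      inc′ : σ (swapAt k u) ⊆Inv σ t
      inc′ = subst (_⊆Inv σ t) (sym (proj₁ (σ-swapAt-ascent (proj₁ bu) k k+1<n ascent)))
                   (swapAt-⊆Inv k (σ u) (σ t) (subst (suc k <_) (sym (σ-length u)) k+1<n) inc reversed)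
      bu′ = BL-swapAt k bu bt inc′
      inv-up = inv-swapAt-ascent k u k+1<n ascent
      step : ∀ fuel → M * M ≤ fuel + inv u → u ≤B t
      step zero       bound = ⊥-elim (fuel-exhausted inv-up (inv≤M² (proj₁ bu′)) bound)
      step (suc fuel) bound =
        (bu , bu′ , swapAt⇒adjSwap k u k+1<n ascent) ◅ go fuel (swapAt k u) bu′ (fuel-step inv-up bound) inc′

  BLcond? : ∀ u → Dec (BLcond u)
  BLcond? u with allUpTo? (λ i → (1 ≤? i) →-dec (firstOcc i u <? firstOcc (suc i) u)) n
  ... | yes all = yes λ i 1≤i i<n → all i<n 1≤i
  ... | no ¬all = no λ bl → ¬all λ i<n 1≤i → bl _ 1≤i i<n

  BL-swapAt? : ∀ {u} k → BL m u → Dec (BL m (swapAt k u))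
  BL-swapAt? {u} k (w , _) = map′ (word-swapAt k w ,_) proj₂ (BLcond? (swapAt k u))

  UpStepToward : List ℕ → List ℕ → ℕ → Set
  UpStepToward u v k = (suc k < length u × nth u k < nth u (suc k)) × BL m (swapAt k u) × swapAt k u ≤B v

  ≤B-within? : ∀ fuel u v → BL m u → inv v ≤ fuel + inv u → Dec (u ≤B v)
  ≤B-within? fuel u v bu bound with ≡-dec _≟_ u v
  ... | yes refl = yes ε
  ... | no u≢v = search fuel bound
    where
    search : ∀ fuel → inv v ≤ fuel + inv u → Dec (u ≤B v)
    search zero bound = no λ u≤v → [ u≢v , (λ inv< → <⇒≱ inv< bound) ] (≤B⇒≡⊎inv< u≤v)
    search (suc fuel) bound with anyUpTo? step? (length u)
      where
      step? : ∀ k → Dec (UpStepToward u v k)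
      step? k with suc k <? length u | nth u k <? nth u (suc k)
      ... | no ¬k+1<n | _          = no λ ((k+1<n , _) , _) → ¬k+1<n k+1<n
      ... | yes _     | no ¬ascent = no λ ((_ , ascent) , _) → ¬ascent ascent
      ... | yes k+1<n | yes ascent with BL-swapAt? k bu
      ...   | no ¬bu′ = no λ (_ , bu′ , _) → ¬bu′ bu′
      ...   | yes bu′ = map′ (λ u′≤v → (k+1<n , ascent) , bu′ , u′≤v) (proj₂ ∘ proj₂)
                         (≤B-within? fuel (swapAt k u) v bu′ (fuel-step (inv-swapAt-ascent k u k+1<n ascent) bound))
    ... | yes (k , _ , (k+1<n , ascent) , bu′ , u′≤v) =
      yes ((bu , bu′ , swapAt⇒adjSwap k u k+1<n ascent) ◅ u′≤v)
    ... | no none = no no-step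
      where
      no-step : ¬ (u ≤B v)
      no-step ε = u≢v refl
      no-step ((_ , bu′ , adj) ◅ u′≤v) with adjSwap⇒swapAt adj
      ... | k , k+1<n , ascent , refl = none (k , <-trans (n<1+n k) k+1<n , (k+1<n , ascent) , bu′ , u′≤v)

  _≤B?_ : ∀ {u} → BL m u → ∀ v → Dec (u ≤B v)
  _≤B?_ {u} bu v = ≤B-within? (inv v) u v bu (m≤m+n _ _)

-- The words s·w₀(J)

length-compose : ∀ π w → length (compose π w) ≡ length w
length-compose π w = length-map _ w

nth-compose : ∀ π w {i} → i < length w → nth (compose π w) i ≡ nth π (nth w i ∸ 1)
nth-compose π w = nth-map _ w

compose-swapAt : ∀ π k w → compose π (swapAt k w) ≡ swapAt k (compose π w)
compose-swapAt π = map-swapAt _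

compose-idPerm : ∀ π {M} → length π ≡ M → compose π (idPerm M) ≡ π
compose-idPerm π {M} refl = nth-ext (trans (length-compose π (idPerm M)) (length-idPerm M)) λ i i<n →
  let i<M = subst (i <_) (trans (length-compose π (idPerm M)) (length-idPerm M)) i<n in
  trans (nth-compose π (idPerm M) (subst (i <_) (sym (length-idPerm M)) i<M))
        (cong (λ v → nth π (v ∸ 1)) (nth-idPerm i<M))

module Translate (m : List ℕ) (positive : All (0 <_) m) {s : List ℕ} (bs : BL m s) where

  open Words m
  open BarcodeOrder m positive

  private
    ws = proj₁ bs

  length-s : length s ≡ M
  length-s = word-length ws

  length-σs : length (σ s) ≡ M
  length-σs = trans (σ-length s) length-s

  module _ (J : Subset (M ∸ 1)) where

    open Parabolic M J

    AscentsOn : Set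
    AscentsOn = ∀ k → suc k < M → contains J k ≡ true → nth s k < nth s (suc k)

    ascentsOn? : Dec AscentsOn
    ascentsOn? = map′ (λ all k k+1<M → all {k} (<-trans (n<1+n k) k+1<M) k+1<M) (λ all {k} _ k+1<M → all k k+1<M)
      (allUpTo? (λ k → (suc k <? M) →-dec ((contains J k Bool.≟ true) →-dec (nth s k <? nth s (suc k)))) M)

    ascentsOn⇒sameBlock-increasing : AscentsOn → ∀ {p q} → p < q → q < M → block J p ≡ block J q →
                                     nth s p < nth s q
    ascentsOn⇒sameBlock-increasing asc = sameBlock-stepwise J (λ a b → nth s a < nth s b) <-trans asc

    sw₀ : List ℕ
    sw₀ = compose s w₀

    private
      bp = w₀-blockPreserving
      <w₀ : ∀ {i} → i < M → i < length w₀
      <w₀ = subst (_ <_) (sym (length≡ bp))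

    sw₀-word : IsWord sw₀
    sw₀-word = ↭-trans (along w₀-path) (subst (_↭ mset m) (sym (compose-idPerm s length-s)) ws)
      where
      along : ∀ {w v} → Star AscentStep w v → compose s v ↭ compose s w
      along ε = _↭_.refl
      along {w} ((k , _ , refl) ◅ path) =
        ↭-trans (along path) (subst (_↭ compose s w) (sym (compose-swapAt s k w)) (swapAt-↭ k (compose s w)))

    -- Along the ascent path from the identity to w₀ each swapped pair lies inside one block,
    -- where s ascends, so standardization commutes with every swap.
    σ-sw₀ : AscentsOn → σ sw₀ ≡ compose (σ s) w₀
    σ-sw₀ asc = along w₀-path blockPreserving-id
      (trans (cong σ (compose-idPerm s length-s)) (sym (compose-idPerm (σ s) length-σs)))
      where
      along : ∀ {w v} → Star AscentStep w v → BlockPreserving w →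
              σ (compose s w) ≡ compose (σ s) w → σ (compose s v) ≡ compose (σ s) v
      along ε _ same = same
      along {w} ((k , (k+1<M , k∈J , ascent) , refl) ◅ path) bpw same =
        along path (blockPreserving-swapAt k k+1<M k∈J bpw)
          (trans (cong σ (compose-swapAt s k w))
          (trans (σ-swapAt (compose s w) k labels-differ)
          (trans (cong (swapAt k) same) (sym (compose-swapAt (σ s) k w)))))
        where
        k<M = <-trans (n<1+n k) k+1<M
        k+1<n = subst (suc k <_) (sym (length≡ bpw)) k+1<M
        labels-differ : nth (compose s w) k ≢ nth (compose s w) (suc k)
        labels-differ same-label =
          <-irrefl (trans (sym (nth-compose s w (<-trans (n<1+n k) k+1<n))) (trans same-label (nth-compose s w k+1<n)))
          (ascentsOn⇒sameBlock-increasing asc (pred-< (proj₁ (range bpw k k<M)) ascent)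
            (pred< (proj₁ (range bpw (suc k) k+1<M)) (proj₂ (range bpw (suc k) k+1<M)))
            (trans (block≡ bpw k k<M) (trans (sym (block-∈ J k k∈J)) (sym (block≡ bpw (suc k) k+1<M)))))

    σs·w₀ : List ℕ
    σs·w₀ = compose (σ s) w₀

    length-σs·w₀ : length σs·w₀ ≡ M
    length-σs·w₀ = trans (length-compose (σ s) w₀) (length≡ bp)

    nth-σs·w₀ : ∀ {i} → i < M → nth σs·w₀ i ≡ nth (σ s) (nth w₀ i ∸ 1)
    nth-σs·w₀ i<M = nth-compose (σ s) w₀ (<w₀ i<M)

    precedes-σs·w₀ : ∀ {p q} → Precedes w₀ (suc p) (suc q) → Precedes σs·w₀ (nth (σ s) p) (nth (σ s) q)
    precedes-σs·w₀ (a , b , a<b , b<n , w₀a , w₀b) =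
      a , b , a<b , subst (b <_) (sym (length-compose (σ s) w₀)) b<n ,
      trans (nth-σs·w₀ (<-trans a<b b<M)) (cong (λ v → nth (σ s) (v ∸ 1)) w₀a) ,
      trans (nth-σs·w₀ b<M) (cong (λ v → nth (σ s) (v ∸ 1)) w₀b)
      where b<M = subst (b <_) (length≡ bp) b<n

    σs⊆Inv-σs·w₀ : AscentsOn → σ s ⊆Inv σs·w₀
    σs⊆Inv-σs·w₀ asc x y x<y (q , p , q<p , p<n , σq , σp) with <-cmp (block J q) (block J p)
    ... | tri< b< _ _ =
      subst₂ (Precedes σs·w₀) σq σp (precedes-σs·w₀ (differentBlocks⇒precedes bp (<-trans q<p p<M) p<M b<))
      where p<M = subst (p <_) length-σs p<n
    ... | tri≈ _ same _ = ⊥-elim (<-asym x<y (subst₂ _<_ σq σp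
                            (σ-label-ascent ws (<-trans q<p p<s) p<s (ascentsOn⇒sameBlock-increasing asc q<p p<M same))))
      where
      p<M = subst (p <_) length-σs p<n
      p<s = subst (p <_) (σ-length s) p<n
    ... | tri> _ _ b> = ⊥-elim (<⇒≱ b> (block-mono J (<⇒≤ q<p)))

  sw₀-injective : ∀ {J J′} → AscentsOn J → AscentsOn J′ → sw₀ J ≡ sw₀ J′ → J ≡ J′
  sw₀-injective {J} {J′} asc asc′ same =
    w₀-injective M J J′ (nth-ext (trans (length≡ bp) (sym (length≡ bp′))) same-entry)
    where
    open Parabolic M using (w₀; w₀-blockPreserving; w₀-pred<; length≡; range)
    bp = w₀-blockPreserving J
    bp′ = w₀-blockPreserving J′
    σs·w₀-same : σs·w₀ J ≡ σs·w₀ J′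
    σs·w₀-same = trans (sym (σ-sw₀ J asc)) (trans (cong σ same) (σ-sw₀ J′ asc′))
    same-entry : ∀ i → i < length (w₀ J) → nth (w₀ J) i ≡ nth (w₀ J′) i
    same-entry i i<n = ∸1-injective (proj₁ (range bp i i<M)) (proj₁ (range bp′ i i<M))
      (σ-distinct ws _ _ (subst (_ <_) (sym length-σs) (w₀-pred< J i<M))
                         (subst (_ <_) (sym length-σs) (w₀-pred< J′ i<M))
        (trans (sym (nth-σs·w₀ J i<M)) (trans (cong (λ π → nth π i) σs·w₀-same) (nth-σs·w₀ J′ i<M))))
      where
      i<M = subst (i <_) (length≡ bp) i<n
      ∸1-injective : ∀ {x y} → 1 ≤ x → 1 ≤ y → x ∸ 1 ≡ y ∸ 1 → x ≡ y
      ∸1-injective {suc x} {suc y} _ _ = cong suc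

  module Interval {t : List ℕ} (bt : BL m t) (s≤t : s ≤B t) where

    private
      wt = proj₁ bt

    Atom : ℕ → Set
    Atom k = suc k < M × nth s k < nth s (suc k) × swapAt k s ≤B t

    atom? : ∀ k → Dec (Atom k)
    atom? k = (suc k <? M) ×-dec (nth s k <? nth s (suc k)) ×-dec below?
      where
      below? : Dec (swapAt k s ≤B t)
      below? with BL-swapAt? k bs
      ... | yes bs′ = bs′ ≤B? t
      ... | no ¬bs′ = no λ s′≤t → ¬bs′ (BL-source s′≤t bt)

    AtomsOn : Subset (M ∸ 1) → Set
    AtomsOn J = ∀ k → suc k < M → contains J k ≡ true → Atom k

    ReversedOn : Subset (M ∸ 1) → Set
    ReversedOn J = ∀ k → suc k < M → contains J k ≡ true → Precedes (σ t) (nth (σ s) (suc k)) (nth (σ s) k)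

    module _ (J : Subset (M ∸ 1)) where

      open Parabolic M J

      private
        bp = w₀-blockPreserving

      σs·w₀⊆Inv⇒reversedOn : AscentsOn J → σs·w₀ J ⊆Inv σ t → ReversedOn J
      σs·w₀⊆Inv⇒reversedOn asc inc k k+1<M k∈J = inc (nth (σ s) k) (nth (σ s) (suc k))
        (σ-label-ascent ws (<-trans (n<1+n k) k+1<s) k+1<s (asc k k+1<M k∈J))
        (precedes-σs·w₀ J (sameBlock⇒reversed bp w₀-noJAscent (n<1+n k) k+1<M (sym (block-∈ J k k∈J))))
        where k+1<s = subst (suc k <_) (sym length-s) k+1<M

      reversedOn⇒σs·w₀⊆Inv : ReversedOn J → σ s ⊆Inv σ t → σs·w₀ J ⊆Inv σ t
      reversedOn⇒σs·w₀⊆Inv rev inc x y x<y (j , i , j<i , i<n , σj , σi) with <-cmp (block J j) (block J i)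
      ... | tri< b< _ _ = inc x y x<y
            (nth w₀ j ∸ 1 , nth w₀ i ∸ 1 ,
             block-<⇒< J (subst₂ _<_ (sym (block≡ bp j j<M)) (sym (block≡ bp i i<M)) b<) ,
             subst (nth w₀ i ∸ 1 <_) (sym length-σs) (w₀-pred< i<M) ,
             trans (sym (nth-σs·w₀ J j<M)) σj , trans (sym (nth-σs·w₀ J i<M)) σi)
        where
        i<M = subst (i <_) (length-σs·w₀ J) i<n
        j<M = <-trans j<i i<M
      ... | tri≈ _ same _ =
            subst₂ (Precedes (σ t)) (trans (sym (nth-σs·w₀ J j<M)) σj) (trans (sym (nth-σs·w₀ J i<M)) σi)
            (sameBlock-stepwise J (λ a b → Precedes (σ t) (nth (σ s) b) (nth (σ s) a))
               (λ ab bc → precedes-trans {σ t} (σ-distinct wt) bc ab) rev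
               (pred-< (proj₁ (range bp i i<M)) (sameBlock⇒decreasing bp w₀-noJAscent j<i i<M same))
               (w₀-pred< j<M)
               (trans (block≡ bp i i<M) (trans (sym same) (sym (block≡ bp j j<M)))))
        where
        i<M = subst (i <_) (length-σs·w₀ J) i<n
        j<M = <-trans j<i i<M
      ... | tri> _ _ b> = ⊥-elim (<⇒≱ b> (block-mono J (<⇒≤ j<i)))

      sw₀≤t⇒atomsOn : AscentsOn J → sw₀ J ≤B t → AtomsOn J
      sw₀≤t⇒atomsOn asc sw₀≤t k k+1<M k∈J = k+1<M , ascent , ⊆Inv⇒≤B (BL-swapAt k bs bt inc) bt inc
        where
        ascent = asc k k+1<M k∈J
        k+1<s = subst (suc k <_) (sym length-s) k+1<M
        reversed = σs·w₀⊆Inv⇒reversedOn asc (subst (_⊆Inv σ t) (σ-sw₀ J asc) (≤B⇒⊆Inv sw₀≤t)) k k+1<M k∈J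
        inc : σ (swapAt k s) ⊆Inv σ t
        inc = subst (_⊆Inv σ t) (sym (proj₁ (σ-swapAt-ascent ws k k+1<s ascent)))
                    (swapAt-⊆Inv k (σ s) (σ t) (subst (suc k <_) (sym length-σs) k+1<M) (≤B⇒⊆Inv s≤t) reversed)

      atomsOn⇒sw₀∈[s,t] : AtomsOn J → AscentsOn J × BL m (sw₀ J) × s ≤B sw₀ J × sw₀ J ≤B t
      atomsOn⇒sw₀∈[s,t] atoms =
        asc , bsw₀ , ⊆Inv⇒≤B bs bsw₀ (subst (σ s ⊆Inv_) (sym (σ-sw₀ J asc)) (σs⊆Inv-σs·w₀ J asc)) ,
        ⊆Inv⇒≤B bsw₀ bt inc
        where
        asc : AscentsOn J
        asc k k+1<M k∈J = proj₁ (proj₂ (atoms k k+1<M k∈J))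
        reversed : ReversedOn J
        reversed k k+1<M k∈J with atoms k k+1<M k∈J
        ... | _ , ascent , s′≤t with σ-swapAt-ascent ws k (subst (suc k <_) (sym length-s) k+1<M) ascent
        ...   | σ-swap , σ-ascent =
          subst (_⊆Inv σ t) σ-swap (≤B⇒⊆Inv s′≤t) _ _ σ-ascent
            (precedes-swapAt-at k (σ s) (subst (suc k <_) (sym length-σs) k+1<M))
        inc : σ (sw₀ J) ⊆Inv σ t
        inc = subst (_⊆Inv σ t) (sym (σ-sw₀ J asc)) (reversedOn⇒σs·w₀⊆Inv reversed (≤B⇒⊆Inv s≤t))
        bsw₀ : BL m (sw₀ J)
        bsw₀ = sw₀-word J , ⊆Inv⇒BLcond positive (sw₀-word J) wt (proj₂ bt) inc

      σt≡σs·w₀⇒t≡sw₀ : σ t ≡ σs·w₀ J → t ≡ sw₀ J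
      σt≡σs·w₀⇒t≡sw₀ σt≡ = nth-ext (trans (word-length wt) (sym length-sw₀)) λ i i<n →
        let i<M = subst (i <_) (word-length wt) i<n in
        trans (σ-label wt ws i<n (subst (_ <_) (sym length-s) (w₀-pred< i<M))
                       (trans (cong (λ π → nth π i) σt≡) (nth-σs·w₀ J i<M)))
              (sym (nth-compose s w₀ (subst (i <_) (sym (length≡ bp)) i<M)))
        where
        length-sw₀ : length (sw₀ J) ≡ M
        length-sw₀ = trans (length-compose s w₀) (length≡ bp)

      σt≡σs·w₀⇒ascentsOn : σ t ≡ σs·w₀ J → AscentsOn J
      σt≡σs·w₀⇒ascentsOn σt≡ k k+1<M k∈J
        with sameBlock⇒reversed bp w₀-noJAscent (n<1+n k) k+1<M (sym (block-∈ J k k∈J))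
      ... | a , b , a<b , b<n , w₀a , w₀b with <-cmp (nth s k) (nth s (suc k))
      ...   | tri< ascent _ _ = ascent
      ...   | tri≈ _ same _ = ⊥-elim (<-asym (σ-repeat-ascent ws (n<1+n k) k+1<s same)
                                (subst₂ _<_ σta σtb (σ-repeat-ascent wt a<b b<t (trans ta (trans (sym same) (sym tb))))))
        where
        b<M = subst (b <_) (length≡ bp) b<n
        b<t = subst (b <_) (sym (word-length wt)) b<M
        k+1<s = subst (suc k <_) (sym length-s) k+1<M
        σta : nth (σ t) a ≡ nth (σ s) (suc k)
        σta = trans (cong (λ π → nth π a) σt≡)
                    (trans (nth-σs·w₀ J (<-trans a<b b<M)) (cong (λ v → nth (σ s) (v ∸ 1)) w₀a))
        σtb : nth (σ t) b ≡ nth (σ s) k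
        σtb = trans (cong (λ π → nth π b) σt≡)
                    (trans (nth-σs·w₀ J b<M) (cong (λ v → nth (σ s) (v ∸ 1)) w₀b))
        ta : nth t a ≡ nth s (suc k)
        ta = σ-label wt ws (<-trans a<b b<t) k+1<s σta
        tb : nth t b ≡ nth s k
        tb = σ-label wt ws b<t (<-trans (n<1+n k) k+1<s) σtb
      ...   | tri> _ _ descent = ⊥-elim (precedes-asym {σ t} (σ-distinct wt) in-t
                (≤B⇒⊆Inv s≤t _ _ (σ-label-ascent ws k+1<s (<-trans (n<1+n k) k+1<s) descent)
                  (k , suc k , n<1+n k , subst (suc k <_) (sym length-σs) k+1<M , refl , refl)))
        where
        k+1<s = subst (suc k <_) (sym length-s) k+1<M
        in-t : Precedes (σ t) (nth (σ s) (suc k)) (nth (σ s) k)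
        in-t = subst (λ π → Precedes π (nth (σ s) (suc k)) (nth (σ s) k)) (sym σt≡)
                 (precedes-σs·w₀ J (a , b , a<b , b<n , w₀a , w₀b))

-- Sums over lists and over subsets

sumOver : ∀ {A : Set} → (A → ℤ) → List A → ℤ
sumOver f L = sumℤ (map f L)

module _ {A : Set} where

  sumOver-cong : ∀ {f g : A → ℤ} L → (∀ x → x ∈ L → f x ≡ g x) → sumOver f L ≡ sumOver g L
  sumOver-cong []      _    = refl
  sumOver-cong (x ∷ L) f≡g = cong₂ _+ℤ_ (f≡g x (here refl)) (sumOver-cong L (λ y y∈L → f≡g y (there y∈L)))

  sumOver-zero : ∀ {f : A → ℤ} L → (∀ x → x ∈ L → f x ≡ 0ℤ) → sumOver f L ≡ 0ℤ
  sumOver-zero []      _   = refl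
  sumOver-zero (x ∷ L) f≡0 = cong₂ _+ℤ_ (f≡0 x (here refl)) (sumOver-zero L (λ y y∈L → f≡0 y (there y∈L)))

  sumOver-+ : ∀ (f g : A → ℤ) L → sumOver (λ x → f x +ℤ g x) L ≡ sumOver f L +ℤ sumOver g L
  sumOver-+ f g []      = refl
  sumOver-+ f g (x ∷ L) = trans (cong (f x +ℤ g x +ℤ_) (sumOver-+ f g L)) (interchange (f x) (g x) _ _)

  sumOver-neg : ∀ (f : A → ℤ) L → sumOver (λ x → -ℤ f x) L ≡ -ℤ sumOver f L
  sumOver-neg f []      = refl
  sumOver-neg f (x ∷ L) = trans (cong (-ℤ f x +ℤ_) (sumOver-neg f L)) (sym (ℤ.neg-distrib-+ (f x) _))

  sumOver-++ : ∀ (f : A → ℤ) L L′ → sumOver f (L ++ L′) ≡ sumOver f L +ℤ sumOver f L′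
  sumOver-++ f []      L′ = sym (ℤ.+-identityˡ _)
  sumOver-++ f (x ∷ L) L′ = trans (cong (f x +ℤ_) (sumOver-++ f L L′)) (sym (ℤ.+-assoc (f x) _ _))

  sumOver-single : ∀ {f : A → ℤ} {t} L → Unique L → t ∈ L → (∀ u → u ∈ L → u ≢ t → f u ≡ 0ℤ) →
                   sumOver f L ≡ f t
  sumOver-single {f} (x ∷ L) (x∉L ∷ _) (here refl) others =
    trans (cong (f x +ℤ_) (sumOver-zero L (λ u u∈L → others u (there u∈L) (λ { refl → All.lookup x∉L u∈L refl }))))
          (ℤ.+-identityʳ (f x))
  sumOver-single {f} (x ∷ L) (x∉L ∷ unique) (there t∈L) others =
    trans (cong (_+ℤ sumOver f L) (others x (here refl) (λ { refl → All.lookup x∉L t∈L refl })))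
          (trans (ℤ.+-identityˡ (sumOver f L)) (sumOver-single L unique t∈L (λ u u∈L → others u (there u∈L))))

  sumOver-determines : ∀ {f g : A → ℤ} {t} L → Unique L → t ∈ L → (∀ u → u ∈ L → u ≢ t → f u ≡ g u) →
                       sumOver f L ≡ sumOver g L → f t ≡ g t
  sumOver-determines {f} {g} (x ∷ L) (x∉L ∷ _) (here refl) others same =
    ∙-cancelʳ (sumOver f L) (f x) (g x)
      (trans same (cong (g x +ℤ_) (sym (sumOver-cong L λ u u∈L →
        others u (there u∈L) (λ { refl → All.lookup x∉L u∈L refl })))))
  sumOver-determines {f} {g} (x ∷ L) (x∉L ∷ unique) (there t∈L) others same =
    sumOver-determines L unique t∈L (λ u u∈L → others u (there u∈L))
      (∙-cancelˡ (f x) _ _ (trans same (cong (_+ℤ sumOver g L)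
        (sym (others x (here refl) (λ { refl → All.lookup x∉L t∈L refl }))))))

sumOver-map : ∀ {A B : Set} (f : B → ℤ) (h : A → B) L → sumOver f (map h L) ≡ sumOver (λ x → f (h x)) L
sumOver-map f h []      = refl
sumOver-map f h (x ∷ L) = cong (f (h x) +ℤ_) (sumOver-map f h L)

sumOver-comm : ∀ {A B : Set} (c : A → B → ℤ) (L : List B) (S : List A) →
               sumOver (λ u → sumOver (λ J → c J u) S) L ≡ sumOver (λ J → sumOver (c J) L) S
sumOver-comm c []      S = sym (sumOver-zero S (λ _ _ → refl))
sumOver-comm c (u ∷ L) S = trans (cong (sumOver (λ J → c J u) S +ℤ_) (sumOver-comm c L S))
                                 (sym (sumOver-+ (λ J → c J u) (λ J → sumOver (c J) L) S))

allSubsets : ∀ k → List (Subset k)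
allSubsets zero    = [] ∷ []
allSubsets (suc k) = map (false ∷_) (allSubsets k) ++ map (true ∷_) (allSubsets k)

sumOver-allSubsets-suc : ∀ k (c : Subset (suc k) → ℤ) →
  sumOver c (allSubsets (suc k)) ≡
  sumOver (λ J → c (false ∷ J)) (allSubsets k) +ℤ sumOver (λ J → c (true ∷ J)) (allSubsets k)
sumOver-allSubsets-suc k c =
  trans (sumOver-++ c (map (false ∷_) (allSubsets k)) _)
        (cong₂ _+ℤ_ (sumOver-map c (false ∷_) (allSubsets k)) (sumOver-map c (true ∷_) (allSubsets k)))

sumOver-allSubsets-single : ∀ k (c : Subset k → ℤ) J₀ → (∀ J → J ≢ J₀ → c J ≡ 0ℤ) →
                            sumOver c (allSubsets k) ≡ c J₀
sumOver-allSubsets-single zero    c []        _      = ℤ.+-identityʳ _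
sumOver-allSubsets-single (suc k) c (false ∷ J₀) others =
  trans (sumOver-allSubsets-suc k c)
        (trans (cong₂ _+ℤ_ (sumOver-allSubsets-single k (λ J → c (false ∷ J)) J₀
                             (λ J J≢J₀ → others _ (J≢J₀ ∘ ∷-injectiveʳ)))
                           (sumOver-zero (allSubsets k) (λ J _ → others _ λ ())))
               (ℤ.+-identityʳ _))
sumOver-allSubsets-single (suc k) c (true ∷ J₀) others =
  trans (sumOver-allSubsets-suc k c)
        (trans (cong₂ _+ℤ_ (sumOver-zero (allSubsets k) (λ J _ → others _ λ ()))
                           (sumOver-allSubsets-single k (λ J → c (true ∷ J)) J₀
                             (λ J J≢J₀ → others _ (J≢J₀ ∘ ∷-injectiveʳ))))
               (ℤ.+-identityˡ _))

allIn : ∀ {k} → Subset k → (ℕ → Bool) → Bool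
allIn []      a = true
allIn (b ∷ J) a = (if b then a 0 else true) ∧ allIn J (a ∘ suc)

allIn-sound : ∀ {k} (J : Subset k) a → allIn J a ≡ true → ∀ i → contains J i ≡ true → a i ≡ true
allIn-sound (true ∷ J) a all zero    _ with a 0 | all
... | true | _ = refl
allIn-sound (b ∷ J)    a all (suc i) i∈J = allIn-sound J (a ∘ suc) (tail b (a 0) all) i i∈J
  where
  tail : ∀ b x {r} → (if b then x else true) ∧ r ≡ true → r ≡ true
  tail true  true  r≡ = r≡
  tail false _     r≡ = r≡

allIn-complete : ∀ {k} (J : Subset k) a → (∀ i → contains J i ≡ true → a i ≡ true) → allIn J a ≡ true
allIn-complete []          a _   = refl
allIn-complete (true ∷ J)  a all rewrite all 0 refl = allIn-complete J (a ∘ suc) (all ∘ suc)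
allIn-complete (false ∷ J) a all = allIn-complete J (a ∘ suc) (all ∘ suc)

signedSubsetSum : ℕ → (ℕ → Bool) → ℤ
signedSubsetSum k a = sumOver (λ J → if allIn J a then sign ∣ J ∣ else 0ℤ) (allSubsets k)

signedSubsetSum-suc : ∀ k a → signedSubsetSum (suc k) a ≡
  signedSubsetSum k (a ∘ suc) +ℤ (if a 0 then -ℤ signedSubsetSum k (a ∘ suc) else 0ℤ)
signedSubsetSum-suc k a =
  trans (sumOver-allSubsets-suc k _) (cong (signedSubsetSum k (a ∘ suc) +ℤ_) (with-first (a 0)))
  where
  with-first : ∀ x → sumOver (λ J → if x ∧ allIn J (a ∘ suc) then -1ℤ *ℤ sign ∣ J ∣ else 0ℤ) (allSubsets k)
                     ≡ (if x then -ℤ signedSubsetSum k (a ∘ suc) else 0ℤ)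
  with-first true = trans (sumOver-cong (allSubsets k) (λ J _ → negate (allIn J (a ∘ suc)) (sign ∣ J ∣)))
                          (sumOver-neg _ (allSubsets k))
    where
    negate : ∀ b x → (if b then -1ℤ *ℤ x else 0ℤ) ≡ -ℤ (if b then x else 0ℤ)
    negate true  x = ℤ.-1*i≡-i x
    negate false x = refl
  with-first false = sumOver-zero (allSubsets k) (λ _ _ → refl)

signedSubsetSum-none : ∀ k a → (∀ i → i < k → a i ≡ false) → signedSubsetSum k a ≡ 1ℤ
signedSubsetSum-none zero    a _    = refl
signedSubsetSum-none (suc k) a none rewrite signedSubsetSum-suc k a | none 0 z<s =
  trans (ℤ.+-identityʳ _) (signedSubsetSum-none k (a ∘ suc) (λ i i<k → none (suc i) (s≤s i<k)))

signedSubsetSum-some : ∀ k a i → i < k → a i ≡ true → signedSubsetSum k a ≡ 0ℤ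
signedSubsetSum-some (suc k) a i i<k ai with a 0 in a0 | i | i<k
... | true  | _     | _         rewrite signedSubsetSum-suc k a | a0 = ℤ.+-inverseʳ (signedSubsetSum k (a ∘ suc))
... | false | zero  | _         = ⊥-elim (false≢true (trans (sym a0) ai))
  where
  false≢true : false ≢ true
  false≢true ()
... | false | suc i | s≤s i<k′ rewrite signedSubsetSum-suc k a | a0 =
  trans (ℤ.+-identityʳ _) (signedSubsetSum-some k (a ∘ suc) i i<k′ ai)

-- The Möbius function

lists : ℕ → ℕ → List (List ℕ)
lists n zero    = [] ∷ []
lists n (suc k) = cartesianProductWith _∷_ (upTo (suc n)) (lists n k)

∈-lists : ∀ n u → (∀ i → i < length u → nth u i ≤ n) → u ∈ lists n (length u)
∈-lists n []      _       = here refl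
∈-lists n (x ∷ u) bounded =
  ∈-cartesianProductWith⁺ _∷_ (∈-upTo⁺ (s≤s (bounded 0 z<s))) (∈-lists n u (λ i i<n → bounded (suc i) (s≤s i<n)))

from-does : ∀ {A : Set} (a? : Dec A) → does a? ≡ true → A
from-does (yes a) _ = a

_≟ₗ_ : (u v : List ℕ) → Dec (u ≡ v)
_≟ₗ_ = ≡-dec _≟_

module Mobius (m : List ℕ) (positive : All (0 <_) m) {s : List ℕ} (bs : BL m s) where

  open Words m
  open BarcodeOrder m positive
  open Translate m positive bs

  term : Subset (M ∸ 1) → List ℕ → ℤ
  term J u = if does (ascentsOn? J ×-dec (u ≟ₗ sw₀ J)) then sign ∣ J ∣ else 0ℤ

  term-sw₀ : ∀ {J} → AscentsOn J → term J (sw₀ J) ≡ sign ∣ J ∣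
  term-sw₀ {J} asc rewrite dec-true (ascentsOn? J ×-dec (sw₀ J ≟ₗ sw₀ J)) (asc , refl) = refl

  term-0 : ∀ {J u} → ¬ (AscentsOn J × u ≡ sw₀ J) → term J u ≡ 0ℤ
  term-0 {J} {u} ¬both rewrite dec-false (ascentsOn? J ×-dec (u ≟ₗ sw₀ J)) ¬both = refl

  -- μ_{S_M}(σ s, σ u), written as a sum over the subsets J with σ u = σ s · w₀(J)
  μWeak : List ℕ → ℤ
  μWeak u = sumOver (λ J → term J u) (allSubsets (M ∸ 1))

  μWeak-sw₀ : ∀ {J} → AscentsOn J → μWeak (sw₀ J) ≡ sign ∣ J ∣
  μWeak-sw₀ {J} asc = trans (sumOver-allSubsets-single (M ∸ 1) (λ J′ → term J′ (sw₀ J)) J others) (term-sw₀ asc)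
    where
    others : ∀ J′ → J′ ≢ J → term J′ (sw₀ J) ≡ 0ℤ
    others J′ J′≢J = term-0 λ (asc′ , same) → J′≢J (sw₀-injective asc′ asc (sym same))

  μWeak-0 : ∀ {u} → (∀ J → AscentsOn J → u ≢ sw₀ J) → μWeak u ≡ 0ℤ
  μWeak-0 none = sumOver-zero (allSubsets (M ∸ 1)) λ J _ → term-0 λ (asc , same) → none J asc same

  module IntervalSums {t : List ℕ} (bt : BL m t) (s≤t : s ≤B t) where

    open Interval bt s≤t

    InInterval : List ℕ → Set
    InInterval u = s ≤B u × u ≤B t

    inInterval? : ∀ u → Dec (InInterval u)
    inInterval? u with bs ≤B? u
    ... | no ¬s≤u = no (¬s≤u ∘ proj₁)
    ... | yes s≤u = map′ (s≤u ,_) proj₂ (BL-target s≤u bs ≤B? t)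

    interval : List (List ℕ)
    interval = deduplicate _≟ₗ_ (filter inInterval? (lists n M))

    interval-unique : Unique interval
    interval-unique = deduplicate-! _≟ₗ_ (filter inInterval? (lists n M))

    ∈-interval⁻ : ∀ {u} → u ∈ interval → BL m u × s ≤B u × u ≤B t
    ∈-interval⁻ u∈
      with ∈-filter⁻ inInterval? {xs = lists n M} (∈-deduplicate⁻ _≟ₗ_ (filter inInterval? (lists n M)) u∈)
    ... | _ , s≤u , u≤t = BL-target s≤u bs , s≤u , u≤t

    ∈-interval⁺ : ∀ {u} → BL m u × s ≤B u × u ≤B t → u ∈ interval
    ∈-interval⁺ {u} (bu , s≤u , u≤t) =
      ∈-deduplicate⁺ _≟ₗ_ (∈-filter⁺ inInterval? (subst (λ l → u ∈ lists n l) (word-length (proj₁ bu))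
                                                        (∈-lists n u (λ i i<n → proj₂ (word-label (proj₁ bu) i i<n))))
                                                  (s≤u , u≤t))

    atomᵇ : ℕ → Bool
    atomᵇ k = does (atom? k)

    sumOver-term : ∀ J → sumOver (term J) interval ≡ (if allIn J atomᵇ then sign ∣ J ∣ else 0ℤ)
    sumOver-term J with allIn J atomᵇ in all-atoms
    ... | true with atomsOn⇒sw₀∈[s,t] J (λ k _ k∈J → from-does (atom? k) (allIn-sound J atomᵇ all-atoms k k∈J))
    ...   | asc , sw₀∈[s,t] =
      trans (sumOver-single interval interval-unique (∈-interval⁺ sw₀∈[s,t]) (λ u _ u≢sw₀ → term-0 (u≢sw₀ ∘ proj₂)))
            (term-sw₀ asc)
    sumOver-term J | false = sumOver-zero interval λ u u∈ → term-0 λ (asc , u≡sw₀) →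
      false≢true (trans (sym all-atoms) (allIn-complete J atomᵇ λ k k∈J →
        dec-true (atom? k) (sw₀≤t⇒atomsOn J asc (subst (_≤B t) u≡sw₀ (proj₂ (proj₂ (∈-interval⁻ u∈))))
                                         k (<pred⇒suc< M (contains-< J k k∈J)) k∈J)))
      where
      false≢true : false ≢ true
      false≢true ()

    -- The interval [s, t] has an atom iff s ≠ t.
    signedSubsetSum-atoms : signedSubsetSum (M ∸ 1) atomᵇ ≡ δ s t
    signedSubsetSum-atoms with s ≟ₗ t
    ... | yes refl = signedSubsetSum-none (M ∸ 1) atomᵇ λ k _ → dec-false (atom? k) λ (k+1<M , ascent , s′≤s) →
      <-irrefl refl (≤-trans (≤-reflexive (sym (inv-swapAt-ascent k s (subst (suc k <_) (sym length-s) k+1<M) ascent)))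
                             (≤B⇒inv≤ s′≤s))
    ... | no s≢t with ≤B-first-step s≤t s≢t
    ...   | k , k+1<n , ascent , s′≤t =
      signedSubsetSum-some (M ∸ 1) atomᵇ k (suc<⇒<pred M k+1<M) (dec-true (atom? k) (k+1<M , ascent , s′≤t))
      where k+1<M = subst (suc k <_) length-s k+1<n

    sumOver-μWeak : sumOver μWeak interval ≡ δ s t
    sumOver-μWeak = trans (sumOver-comm term interval (allSubsets (M ∸ 1)))
                    (trans (sumOver-cong (allSubsets (M ∸ 1)) (λ J _ → sumOver-term J)) signedSubsetSum-atoms)

  module _ (μ : List ℕ → List ℕ → ℤ) (isMobius : IsMobius (BL m) (λ s t → s ≤BL[ m ] t) μ) where

    μ≡μWeak-below : ∀ N {t} → inv t < N → BL m t → s ≤B t → μ s t ≡ μWeak t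
    μ≡μWeak-below (suc N) {t} inv<N bt s≤t =
      sumOver-determines interval interval-unique (∈-interval⁺ (bt , s≤t , ε)) below
        (trans (isMobius s t bs bt s≤t interval interval-unique (λ u → mk⇔ ∈-interval⁻ ∈-interval⁺))
               (sym sumOver-μWeak))
      where
      open IntervalSums bt s≤t
      below : ∀ u → u ∈ interval → u ≢ t → μ s u ≡ μWeak u
      below u u∈ u≢t with ∈-interval⁻ u∈
      ... | bu , s≤u , u≤t with ≤B⇒≡⊎inv< u≤t
      ...   | inj₁ u≡t  = ⊥-elim (u≢t u≡t)
      ...   | inj₂ inv< = μ≡μWeak-below N (<-≤-trans inv< (≤-pred inv<N)) bu s≤u

    μ≡μWeak : ∀ {t} → BL m t → s ≤B t → μ s t ≡ μWeak t
    μ≡μWeak {t} = μ≡μWeak-below (suc (inv t)) ≤-refl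

proposition3p2 :
    (m : List ℕ) → All (0 <_) m →
    (μ : List ℕ → List ℕ → ℤ) → IsMobius (BL m) (λ s t → s ≤BL[ m ] t) μ →
    (s t : List ℕ) → BL m s → BL m t → s ≤BL[ m ] t →
    ((J : Subset (totalM m ∸ 1)) (w : List ℕ) → IsW0 (totalM m) J w →
       toPerm m t ≡ compose (toPerm m s) w → μ s t ≡ sign ∣ J ∣)
    × (((J : Subset (totalM m ∸ 1)) (w : List ℕ) → IsW0 (totalM m) J w →
       toPerm m t ≢ compose (toPerm m s) w) → μ s t ≡ 0ℤ)
proposition3p2 m positive μ isMobius s t bs bt s≤t = at-w₀ , elsewhere
  where
  open Words m
  open Translate m positive bs
  open Interval bt s≤t
  open Mobius m positive bs

  at-w₀ : ∀ J w → IsW0 M J w → σ t ≡ compose (σ s) w → μ s t ≡ sign ∣ J ∣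
  at-w₀ J w isW0 σt≡σs·w with Parabolic.isW0⇒≡w₀ M J isW0
  ... | refl = begin
    μ s t         ≡⟨ μ≡μWeak μ isMobius bt s≤t ⟩
    μWeak t       ≡⟨ cong μWeak (σt≡σs·w₀⇒t≡sw₀ J σt≡σs·w) ⟩
    μWeak (sw₀ J) ≡⟨ μWeak-sw₀ (σt≡σs·w₀⇒ascentsOn J σt≡σs·w) ⟩
    sign ∣ J ∣    ∎
    where open ≡-Reasoning

  elsewhere : (∀ J w → IsW0 M J w → σ t ≢ compose (σ s) w) → μ s t ≡ 0ℤ
  elsewhere none = trans (μ≡μWeak μ isMobius bt s≤t) (μWeak-0 λ J asc t≡sw₀ →
    none J _ (Parabolic.w₀-isW0 M J) (trans (cong σ t≡sw₀) (σ-sw₀ J asc)))
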